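{- Let $p>2$ and let $G$ be a finite $p$-group. Then $G$ is a minimal nonabelian $p$-group if and only if: (i) $G$ is nilpotent of class $2$; (ii) $Z(G)$ is cyclic of order $p^d$ for some $d\ge1$; (iii) $[G,G]$ is the subgroup of $Z(G)$ of order $p$; (iv) $G/Z(G)$ is an elementary abelian $p$-group of rank $2n$ for some $n\ge1$, and the commutator induces a nondegenerate skew-symmetric $\mathbb{F}_p$-bilinear form on $G/Z(G)$ with values in $[G,G]$.
   Context: For finite $p$-groups write $H\preccurlyeq G$ if $H$ is isomorphic to a quotient of $G$. A minimal nonabelian $p$-group is a finite nonabelian $p$-group which is $\preccurlyeq$-minimal among nonabelian $p$-groups. -}

module Defs where

open import Data.Nat using (ℕ; zero; suc; _^_)
open import Data.Fin using (Fin)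
open import Data.Product using (Σ; ∃; _×_; _,_)
open import Relation.Binary.PropositionalEquality using (_≡_; _≢_)
open import Relation.Nullary using (¬_)
open import Algebra.Structures using (IsGroup)

record FinGroup : Set where
  field
    order   : ℕ
    _·_     : Fin order → Fin order → Fin order
    e       : Fin order
    inv     : Fin order → Fin order
    isGroup : IsGroup _≡_ _·_ e inv

  Carrier : Set
  Carrier = Fin order

HasSize : ∀ {n} → (Fin n → Set) → ℕ → Set
HasSize {n} P m =
  Σ (Fin m → Fin n) λ f →
    (∀ i j → f i ≡ f j → i ≡ j) × (∀ i → P (f i)) × (∀ x → P x → ∃ λ i → f i ≡ x)

module _ (G : FinGroup) where
  open FinGroup G

  pow : Carrier → ℕ → Carrier
  pow x zero    = e
  pow x (suc k) = x · pow x k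

  comm : Carrier → Carrier → Carrier
  comm x y = inv x · (inv y · (x · y))

  Abelian : Set
  Abelian = ∀ x y → x · y ≡ y · x

  Nonabelian : Set
  Nonabelian = ¬ Abelian

  Center : Carrier → Set
  Center x = ∀ y → x · y ≡ y · x

  data Gen (S : Carrier → Set) : Carrier → Set where
    gen-e   : Gen S e
    gen-s   : ∀ {x} → S x → Gen S x
    gen-inv : ∀ {x} → Gen S x → Gen S (inv x)
    gen-mul : ∀ {x y} → Gen S x → Gen S y → Gen S (x · y)

  IsCommutator : Carrier → Set
  IsCommutator c = ∃ λ x → ∃ λ y → c ≡ comm x y

  Derived : Carrier → Set
  Derived = Gen IsCommutator

  -- nilpotent of class exactly 2: γ₂(G) ≠ 1 and γ₃(G) = [γ₂(G), G] = 1
  NilpotentClass2 : Set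
  NilpotentClass2 =
    (∃ λ c → Derived c × c ≢ e) × (∀ c g → Derived c → comm c g ≡ e)

  record IsNormal (N : Carrier → Set) : Set where
    field
      N-e    : N e
      N-mul  : ∀ {x y} → N x → N y → N (x · y)
      N-inv  : ∀ {x} → N x → N (inv x)
      N-conj : ∀ {x} g → N x → N (inv g · (x · g))

  _∼[_]_ : Carrier → (Carrier → Set) → Carrier → Set
  x ∼[ N ] y = N (inv x · y)

  QuotientSize : (Carrier → Set) → ℕ → Set
  QuotientSize N m =
    Σ (Fin m → Carrier) λ r →
      (∀ i j → r i ∼[ N ] r j → i ≡ j) × (∀ g → ∃ λ i → r i ∼[ N ] g)

  QuotientElemAbelian : (Carrier → Set) → ℕ → ℕ → Set
  QuotientElemAbelian N p k =
    (∀ x y → (x · y) ∼[ N ] (y · x)) ×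
    (∀ x → pow x p ∼[ N ] e) ×
    QuotientSize N (p ^ k)

  CommutatorFormOnCentralQuotient : Set
  CommutatorFormOnCentralQuotient =
    (∀ x x′ y y′ → x ∼[ Center ] x′ → y ∼[ Center ] y′ → comm x y ≡ comm x′ y′) ×
    (∀ x y → Derived (comm x y)) ×
    (∀ x x′ y → comm (x · x′) y ≡ comm x y · comm x′ y) ×
    (∀ x y y′ → comm x (y · y′) ≡ comm x y · comm x y′) ×
    (∀ x y → comm y x ≡ inv (comm x y)) ×
    (∀ x → (∀ y → comm x y ≡ e) → x ∼[ Center ] e)

IsPGroup : ℕ → FinGroup → Set
IsPGroup p G = ∃ λ k → FinGroup.order G ≡ p ^ k

_≅_ : FinGroup → FinGroup → Set
H ≅ G =
  Σ (FinGroup.Carrier H → FinGroup.Carrier G) λ f →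
    (∀ a b → f (a H.· b) ≡ f a G.· f b) ×
    (∀ a b → f a ≡ f b → a ≡ b) ×
    (∀ y → ∃ λ a → f a ≡ y)
  where
    module H = FinGroup H
    module G = FinGroup G

-- H ≼ G : H is isomorphic to a quotient G/N by a normal subgroup N of G.
-- An isomorphism H → G/N is given by a map f into G (choosing coset
-- representatives) that is a homomorphism, injective and surjective modulo N.
_≼_ : FinGroup → FinGroup → Set₁
H ≼ G =
  Σ (FinGroup.Carrier G → Set) λ N →
    IsNormal G N ×
    Σ (FinGroup.Carrier H → FinGroup.Carrier G) λ f →
      (∀ a b → _∼[_]_ G (f (a H.· b)) N (f a G.· f b)) ×
      (∀ a b → _∼[_]_ G (f a) N (f b) → a ≡ b) ×
      (∀ g → ∃ λ a → _∼[_]_ G (f a) N g)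
  where
    module H = FinGroup H
    module G = FinGroup G

MinimalNonabelian : ℕ → FinGroup → Set₁
MinimalNonabelian p G =
  IsPGroup p G × Nonabelian G ×
  (∀ H → IsPGroup p H → Nonabelian H → H ≼ G → H ≅ G)

{-# OPTIONS --safe #-}
module Submission where

-- If G is minimal nonabelian, every nontrivial normal subgroup N contains [G,G], because G/N is a
-- smaller p-group and hence abelian.  Taking N = ⟨y⟩ for a central y of order p (which exists by
-- the class equation) gives [G,G] = ⟨y⟩ ≤ Z(G); taking N = ⟨w⟩ for any central w of order p shows
-- that ⟨y⟩ is the only subgroup of order p of Z(G), so Z(G) is cyclic.  The commutator is then a
-- nondegenerate alternating bilinear form on G/Z(G) with values in ⟨y⟩ ≅ 𝔽ₚ, and splitting off
-- hyperbolic pairs x, w with [x,w] ≠ 1 gives |G/Z(G)| = p^(2n).  Conversely, under (i)–(iii) a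
-- nontrivial normal subgroup meets [G,G] nontrivially (in a commutator [x,y] if it is not central,
-- in the unique subgroup of order p of the cyclic Z(G) if it is), so it contains [G,G] and the
-- corresponding quotient is abelian.

open import Defs
open import Algebra.Bundles using (Group)
import Algebra.Properties.Group as GroupProperties
open import Algebra.Structures using (IsGroup)
open import Data.Bool using (if_then_else_)
open import Data.Fin using (Fin; zero; suc; toℕ; fromℕ<)
open import Data.Fin.Properties using (any?; all?; ¬∀⟶∃¬; injective⇒≤; pigeonhole; suc-injective; toℕ-fromℕ<; toℕ-injective; toℕ<n) renaming (_≟_ to _≟ᶠ_)
open import Data.Nat using (ℕ; zero; suc; pred; _+_; _*_; _∸_; _^_; _%_; _/_; _≤_; _<_; z≤n; s≤s; NonZero; >-nonZero; nonTrivial⇒n>1)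
open import Data.Nat.Coprimality using (Coprime; coprime-divisor)
open import Data.Nat.DivMod using (m≡m%n+[m/n]*n; m%n<n)
open import Data.Nat.Divisibility using (_∣_; divides; _∣?_; _∣0; ∣1⇒≡1; ∣m∣n⇒∣m+n; ∣m+n∣m⇒∣n; ∣⇒≤; *-cancelʳ-∣)
open import Data.Nat.Primality using (Prime; prime⇒irreducible; prime⇒nonZero; prime⇒nonTrivial)
open import Data.Nat.Properties using (*-assoc; *-cancelˡ-≡; *-comm; *-distribˡ-+; *-identityʳ; *-suc; *-zeroʳ; +-*-semiring; +-comm; +-suc; +-∸-assoc; <-cmp; <-irrefl; <-≤-trans; <⇒≤; <⇒≱; ^-distribˡ-+-*; ^-monoʳ-<; _<?_; _≤?_; m+[n∸m]≡n; m<m*n; m^n≢0; m∸n+n≡m; m∸n≡0⇒m≤n; m∸n≤m; m≤m*n; n<1+n; n≤1+n; ∸-monoʳ-<; ≤-<-trans; ≤-antisym; ≤-pred; ≤-refl; ≤-reflexive; ≤-total; ≤-trans; ≮⇒≥; ≰⇒>)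
open import Algebra.Properties.Semiring.Sum +-*-semiring using (sum; sum-cong-≗; sum-replicate-zero; ∑-distrib-+; *-distribˡ-sum)
open import Data.Nat.Solver using (module +-*-Solver)
open import Data.Product using (∃; _×_; _,_; proj₁; proj₂)
open import Data.Sum using (inj₁; inj₂; [_,_]′)
open import Data.Unit using (tt)
open import Function using (_∘_; id)
open import Function.Bundles using (_⇔_; mk⇔)
open import Level using (0ℓ)
open import Relation.Binary using (Rel; IsEquivalence; DecidableEquality; tri<; tri≈; tri>)
open import Relation.Binary.PropositionalEquality using (_≡_; _≢_; refl; sym; trans; cong; cong₂; subst; subst₂; isEquivalence; module ≡-Reasoning)
open import Relation.Nullary using (¬_; Dec; yes; no; does; _×-dec_; _→-dec_; contradiction)
open import Relation.Unary using (Decidable; _≐_; U)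
open import Relation.Unary.Properties using (U?; _∩?_)

∣p^k⇒≡p^i : ∀ {p} → Prime p → ∀ k {m} → m ∣ p ^ k → ∃ λ i → m ≡ p ^ i
∣p^k⇒≡p^i p-prime zero    m∣1 = 0 , ∣1⇒≡1 m∣1
∣p^k⇒≡p^i {p} p-prime (suc k) {m} m∣p^[1+k] with p ∣? m
... | yes (divides q refl) =
  let instance _ = prime⇒nonZero p-prime
      (i , q≡p^i) = ∣p^k⇒≡p^i p-prime k (*-cancelʳ-∣ p (subst (q * p ∣_) (*-comm p (p ^ k)) m∣p^[1+k]))
  in suc i , trans (*-comm q p) (cong (p *_) q≡p^i)
... | no p∤m = ∣p^k⇒≡p^i p-prime k (coprime-divisor m⊥p m∣p^[1+k])
  where
  m⊥p : Coprime m p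
  m⊥p (i∣m , i∣p) with prime⇒irreducible p-prime i∣p
  ... | inj₁ i≡1  = i≡1
  ... | inj₂ refl = contradiction i∣m p∤m

^-cancelʳ-≤ : ∀ {p} → 1 < p → ∀ {i j} → p ^ i ≤ p ^ j → i ≤ j
^-cancelʳ-≤ {p} 1<p {i} {j} p^i≤p^j with i ≤? j
... | yes i≤j = i≤j
... | no  i≰j = contradiction p^i≤p^j (<⇒≱ (^-monoʳ-< p 1<p (≰⇒> i≰j)))

prime⇒1<p : ∀ {p} → Prime p → 1 < p
prime⇒1<p {p} p-prime = nonTrivial⇒n>1 p {{prime⇒nonTrivial p-prime}}

module Counting where

  private
    variable
      n n′ m a b c : ℕ
      P Q : Fin n → Set

  indicator : ∀ {ℓ} {A : Set ℓ} → Dec A → ℕ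
  indicator a? = if does a? then 1 else 0

  count : Decidable P → ℕ
  count P? = sum (indicator ∘ P?)

  private
    hasSize-∷ : P zero → HasSize (P ∘ suc) m → HasSize P (suc m)
    hasSize-∷ {P = P} p0 (f , f-inj , f∈ , f-onto) = g , g-inj , g∈ , g-onto
      where
      g : Fin (suc _) → Fin (suc _)
      g zero    = zero
      g (suc i) = suc (f i)
      g-inj : ∀ i j → g i ≡ g j → i ≡ j
      g-inj zero    zero    _  = refl
      g-inj zero    (suc _) ()
      g-inj (suc _) zero    ()
      g-inj (suc i) (suc j) eq = cong suc (f-inj i j (suc-injective eq))
      g∈ : ∀ i → P (g i)
      g∈ zero    = p0
      g∈ (suc i) = f∈ i
      g-onto : ∀ x → P x → ∃ λ i → g i ≡ x
      g-onto zero    _  = zero , refl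
      g-onto (suc x) px with f-onto x px
      ... | i , refl = suc i , refl

    hasSize-∷ᶜ : ¬ P zero → HasSize (P ∘ suc) m → HasSize P m
    hasSize-∷ᶜ {P = P} ¬p0 (f , f-inj , f∈ , f-onto) =
      suc ∘ f , (λ i j → f-inj i j ∘ suc-injective) , f∈ , g-onto
      where
      g-onto : ∀ x → P x → ∃ λ i → suc (f i) ≡ x
      g-onto zero    px = contradiction px ¬p0
      g-onto (suc x) px with f-onto x px
      ... | i , refl = i , refl

  count-hasSize : (P? : Decidable P) → HasSize P (count P?)
  count-hasSize {zero}  P? = (λ ()) , (λ ()) , (λ ()) , (λ ())
  count-hasSize {suc n} P? with P? zero
  ... | yes p0 = hasSize-∷ p0 (count-hasSize (P? ∘ suc))
  ... | no ¬p0 = hasSize-∷ᶜ ¬p0 (count-hasSize (P? ∘ suc))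

  hasSize-≤ : ∀ {n n′ a b} {P : Fin n → Set} {Q : Fin n′ → Set} → HasSize P a → HasSize Q b → (g : Fin n → Fin n′) → (∀ {x} → P x → Q (g x)) →
              (∀ {x y} → P x → P y → g x ≡ g y → x ≡ y) → a ≤ b
  hasSize-≤ {a = a} {b} (f , f-inj , f∈ , _) (h , _ , _ , h-onto) g g∈ g-inj = injective⇒≤ k-inj
    where
    k : Fin a → Fin b
    k i = proj₁ (h-onto (g (f i)) (g∈ (f∈ i)))
    h∘k : ∀ i → h (k i) ≡ g (f i)
    h∘k i = proj₂ (h-onto (g (f i)) (g∈ (f∈ i)))
    k-inj : ∀ {i j} → k i ≡ k j → i ≡ j
    k-inj {i} {j} eq = f-inj i j (g-inj (f∈ i) (f∈ j) (trans (sym (h∘k i)) (trans (cong h eq) (h∘k j))))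

  hasSize-unique : P ≐ Q → HasSize P a → HasSize Q b → a ≡ b
  hasSize-unique (P⊆Q , Q⊆P) hP hQ =
    ≤-antisym (hasSize-≤ hP hQ (λ x → x) P⊆Q (λ _ _ eq → eq)) (hasSize-≤ hQ hP (λ x → x) Q⊆P (λ _ _ eq → eq))

  hasSize-cong : P ≐ Q → HasSize P m → HasSize Q m
  hasSize-cong (P⊆Q , Q⊆P) (f , f-inj , f∈ , f-onto) = f , f-inj , P⊆Q ∘ f∈ , λ x → f-onto x ∘ Q⊆P

  hasSize⇒decidable : ∀ {n m} {P : Fin n → Set} → HasSize P m → Decidable P
  hasSize⇒decidable {P = P} (f , _ , f∈ , f-onto) x with any? (λ i → f i ≟ᶠ x)
  ... | yes (i , refl) = yes (f∈ i)
  ... | no  x∉image    = no (x∉image ∘ f-onto x)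

  hasSize⇒count≡ : (P? : Decidable P) → HasSize P m → count P? ≡ m
  hasSize⇒count≡ P? = hasSize-unique ((λ p → p) , (λ p → p)) (count-hasSize P?)

  count-cong : (P? : Decidable P) (Q? : Decidable Q) → P ≐ Q → count P? ≡ count Q?
  count-cong P? Q? P≐Q = hasSize-unique P≐Q (count-hasSize P?) (count-hasSize Q?)

  count-mono : (P? : Decidable P) (Q? : Decidable Q) → (∀ {x} → P x → Q x) → count P? ≤ count Q?
  count-mono P? Q? P⊆Q = hasSize-≤ (count-hasSize P?) (count-hasSize Q?) (λ x → x) P⊆Q (λ _ _ eq → eq)

  count-≡ : ∀ {n n′} {P : Fin n → Set} {Q : Fin n′ → Set} (P? : Decidable P) (Q? : Decidable Q) →
            (f : Fin n → Fin n′) → (∀ {x} → P x → Q (f x)) → (∀ {x y} → P x → P y → f x ≡ f y → x ≡ y) →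
            (g : Fin n′ → Fin n) → (∀ {y} → Q y → P (g y)) → (∀ {x y} → Q x → Q y → g x ≡ g y → x ≡ y) →
            count P? ≡ count Q?
  count-≡ P? Q? f f∈ f-inj g g∈ g-inj = ≤-antisym
    (hasSize-≤ (count-hasSize P?) (count-hasSize Q?) f f∈ f-inj)
    (hasSize-≤ (count-hasSize Q?) (count-hasSize P?) g g∈ g-inj)

  count-U : count (U? {A = Fin n}) ≡ n
  count-U = hasSize⇒count≡ U? ((λ i → i) , (λ _ _ eq → eq) , _ , (λ x _ → x , refl))

  count-singleton : (a : Fin n) → count (a ≟ᶠ_) ≡ 1
  count-singleton a = hasSize⇒count≡ (a ≟ᶠ_) ((λ _ → a) , (λ { zero zero _ → refl }) , (λ _ → refl) , (λ _ a≡x → zero , a≡x))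

  ≤-count : (P? : Decidable P) (f : Fin m → Fin n) → (∀ i j → f i ≡ f j → i ≡ j) → (∀ i → P (f i)) → m ≤ count P?
  ≤-count P? f f-inj f∈ = hasSize-≤ {P = U} ((λ i → i) , (λ _ _ eq → eq) , _ , (λ x _ → x , refl)) (count-hasSize P?) f (λ {i} _ → f∈ i) (λ {i} {j} _ _ → f-inj i j)

  ∈⇒0<count : (P? : Decidable P) → ∀ {x} → P x → 0 < count P?
  ∈⇒0<count P? {x} px = ≤-count P? (λ _ → x) (λ { zero zero _ → refl }) (λ _ → px)

  ≢⇒2≤count : ∀ {n} {P : Fin n → Set} (P? : Decidable P) → ∀ {x y} → P x → P y → x ≢ y → 2 ≤ count P?
  ≢⇒2≤count {n} {P} P? {x} {y} px py x≢y = ≤-count P? f f-inj f∈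
    where
    f : Fin 2 → Fin n
    f zero = x
    f (suc _) = y
    f-inj : ∀ i j → f i ≡ f j → i ≡ j
    f-inj zero          zero          _  = refl
    f-inj zero          (suc zero)    eq = contradiction eq x≢y
    f-inj (suc zero)    zero          eq = contradiction (sym eq) x≢y
    f-inj (suc zero)    (suc zero)    _  = refl
    f∈ : ∀ i → P (f i)
    f∈ zero    = px
    f∈ (suc _) = py

  count≤1⇒unique : (P? : Decidable P) → count P? ≤ 1 → ∀ {x y} → P x → P y → x ≡ y
  count≤1⇒unique P? ≤1 {x} {y} px py with x ≟ᶠ y
  ... | yes x≡y = x≡y
  ... | no x≢y = contradiction (≤-trans (≢⇒2≤count P? px py x≢y) ≤1) (λ { (s≤s ()) })

  ¬⊆⇒∃∖ : ∀ {n} {P Q : Fin n → Set} → Decidable P → Decidable Q → ¬ (∀ x → P x → Q x) → ∃ λ x → P x × ¬ Q x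
  ¬⊆⇒∃∖ {P = P} {Q} P? Q? ¬P⊆Q with ¬∀⟶∃¬ _ (λ x → P x → Q x) (λ x → P? x →-dec Q? x) ¬P⊆Q
  ... | x , ¬[Px→Qx] with P? x
  ...   | yes px = x , px , λ qx → ¬[Px→Qx] (λ _ → qx)
  ...   | no ¬px = contradiction (λ px → contradiction px ¬px) ¬[Px→Qx]

  2≤count⇒∃≢ : (P? : Decidable P) → 2 ≤ count P? → ∀ a → ∃ λ x → P x × x ≢ a
  2≤count⇒∃≢ P? 2≤ a = ¬⊆⇒∃∖ P? (_≟ᶠ a) λ P⊆≡a →
    contradiction (≤-trans 2≤ (≤-trans (count-mono P? (a ≟ᶠ_) (sym ∘ P⊆≡a _)) (≤-reflexive (count-singleton a)))) (λ { (s≤s ()) })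

  count-∅ : ∀ {n} {P : Fin n → Set} (P? : Decidable P) → (∀ x → ¬ P x) → count P? ≡ 0
  count-∅ {n = n} P? ∅ = trans (sum-cong-≗ (λ x → indicator-no (P? x) (∅ x))) (sum-replicate-zero n)
    where
    indicator-no : ∀ {A : Set} (a? : Dec A) → ¬ A → indicator a? ≡ 0
    indicator-no (yes a) ¬a = contradiction a ¬a
    indicator-no (no _)  _  = refl

  count-≥⇒⊇ : ∀ {n} {P Q : Fin n → Set} (P? : Decidable P) (Q? : Decidable Q) → (∀ {x} → P x → Q x) → count Q? ≤ count P? → ∀ {x} → Q x → P x
  count-≥⇒⊇ {n} {P} {Q} P? Q? P⊆Q Q≤P {x} qx with P? x | count-hasSize P?
  ... | yes px | _ = px
  ... | no ¬px | f , f-inj , f∈ , _ = contradiction Q≤P (<⇒≱ (≤-count Q? g g-inj g∈))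
    where
    g : Fin (suc (count P?)) → Fin n
    g zero    = x
    g (suc i) = f i
    g-inj : ∀ i j → g i ≡ g j → i ≡ j
    g-inj zero    zero    _  = refl
    g-inj zero    (suc j) eq = contradiction (subst _ (sym eq) (f∈ j)) ¬px
    g-inj (suc i) zero    eq = contradiction (subst _ eq (f∈ i)) ¬px
    g-inj (suc i) (suc j) eq = cong suc (f-inj i j eq)
    g∈ : ∀ i → Q (g i)
    g∈ zero    = qx
    g∈ (suc i) = P⊆Q (f∈ i)

  Image : (P : Fin n → Set) → (Fin n → Fin m) → Fin m → Set
  Image P φ j = ∃ λ x → P x × φ x ≡ j

  image? : Decidable P → (φ : Fin n → Fin m) → Decidable (Image P φ)
  image? P? φ j = any? (λ x → P? x ×-dec (φ x ≟ᶠ j))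

  count-∑-fibres : ∀ {n m} {P : Fin n → Set} (P? : Decidable P) (φ : Fin n → Fin m) →
                   count P? ≡ sum (λ j → count (P? ∩? (λ x → φ x ≟ᶠ j)))
  count-∑-fibres {n = zero} {m = m} P? φ = sym (sum-replicate-zero m)
  count-∑-fibres {n = suc n} {m = m} {P = P} P? φ = begin
    indicator (P? zero) + count (P? ∘ suc)
      ≡⟨ cong₂ _+_ (head-fibre (P? zero)) (count-∑-fibres {P = P ∘ suc} (P? ∘ suc) (φ ∘ suc)) ⟩
    sum (λ j → indicator (P? zero ×-dec (φ zero ≟ᶠ j))) + sum (λ j → count ((P? ∘ suc) ∩? (λ x → φ (suc x) ≟ᶠ j)))
      ≡⟨ sym (∑-distrib-+ (λ j → indicator (P? zero ×-dec (φ zero ≟ᶠ j))) (λ j → count ((P? ∘ suc) ∩? (λ x → φ (suc x) ≟ᶠ j)))) ⟩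
    sum (λ j → count (P? ∩? (λ x → φ x ≟ᶠ j))) ∎
    where
    open ≡-Reasoning
    head-fibre : (d : Dec (P zero)) → indicator d ≡ sum (λ j → indicator (d ×-dec (φ zero ≟ᶠ j)))
    head-fibre (yes _) = sym (count-singleton (φ zero))
    head-fibre (no _)  = sym (sum-replicate-zero m)

  count-uniform-fibres : ∀ {n m c} {P : Fin n → Set} (P? : Decidable P) (φ : Fin n → Fin m) →
                         (∀ {x} → P x → count (P? ∩? (λ y → φ y ≟ᶠ φ x)) ≡ c) →
                         count P? ≡ c * count (image? P? φ)
  count-uniform-fibres {m = m} {c = c} {P = P} P? φ uniform = begin
    count P?                                           ≡⟨ count-∑-fibres {P = P} P? φ ⟩
    sum (λ j → count (P? ∩? (λ y → φ y ≟ᶠ j)))         ≡⟨ sum-cong-≗ fibre-size ⟩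
    sum (λ j → c * indicator (image? P? φ j))          ≡⟨ sym (*-distribˡ-sum c (indicator ∘ image? P? φ)) ⟩
    c * count (image? P? φ)                            ∎
    where
    open ≡-Reasoning
    fibre-size : ∀ j → count (P? ∩? (λ y → φ y ≟ᶠ j)) ≡ c * indicator (image? P? φ j)
    fibre-size j with image? P? φ j
    ... | yes (x , px , refl) = trans (uniform px) (sym (*-identityʳ c))
    ... | no  j∉im            = trans (count-∅ (P? ∩? (λ y → φ y ≟ᶠ j)) (λ y (py , φy≡j) → j∉im (y , py , φy≡j))) (sym (*-zeroʳ c))

  ∣-sum : ∀ {d n} (f : Fin n → ℕ) → (∀ i → d ∣ f i) → d ∣ sum f
  ∣-sum {d} {zero}  f _   = d ∣0
  ∣-sum {d} {suc n} f d∣f = ∣m∣n⇒∣m+n (d∣f zero) (∣-sum (f ∘ suc) (d∣f ∘ suc))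

  minimum : ∀ {n} {P : Fin n → Set} (P? : Decidable P) → ∀ {x} → P x →
            ∃ λ y → P y × (∀ {z} → P z → toℕ y ≤ toℕ z)
  minimum {suc n} {P} P? {x} px with P? zero | x
  ... | yes p0 | _     = zero , p0 , λ _ → z≤n
  ... | no ¬p0 | zero  = contradiction px ¬p0
  ... | no ¬p0 | suc x with minimum (P? ∘ suc) px
  ...   | y , py , y-min = suc y , py , suc-min
    where
    suc-min : ∀ {z} → P z → toℕ (suc y) ≤ toℕ z
    suc-min {zero}  p0 = contradiction p0 ¬p0
    suc-min {suc z} pz = s≤s (y-min pz)

  maximum : ∀ {n} {P : Fin n → Set} (P? : Decidable P) (f : Fin n → ℕ) → ∀ {x} → P x →
            ∃ λ y → P y × (∀ {z} → P z → f z ≤ f y)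
  maximum {suc n} {P} P? f {x} px with any? (P? ∘ suc)
  ... | yes (i , pi) = extend (maximum (P? ∘ suc) (f ∘ suc) pi) (P? zero)
    where
    extend : (∃ λ y → P (suc y) × (∀ {z} → P (suc z) → f (suc z) ≤ f (suc y))) → Dec (P zero) →
             ∃ λ y → P y × (∀ {z} → P z → f z ≤ f y)
    extend (y , py , y-max) (no ¬p0) = suc y , py , λ { {zero} p0 → contradiction p0 ¬p0 ; {suc z} pz → y-max pz }
    extend (y , py , y-max) (yes p0) with ≤-total (f zero) (f (suc y))
    ... | inj₁ f0≤fy = suc y , py , λ { {zero} _ → f0≤fy ; {suc z} pz → y-max pz }
    ... | inj₂ fy≤f0 = zero , p0 , λ { {zero} _ → ≤-refl ; {suc z} pz → ≤-trans (y-max pz) fy≤f0 }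
  ... | no ¬tail with x
  ...   | zero   = zero , px , λ { {zero} _ → ≤-refl ; {suc z} pz → contradiction (z , pz) ¬tail }
  ...   | suc x′ = contradiction (x′ , px) ¬tail

  record Transversal {n} (_~_ : Rel (Fin n) 0ℓ) : Set where
    field
      rep      : Fin n → Fin n
      rep-~    : ∀ x → x ~ rep x
      rep-cong : ∀ {x y} → x ~ y → rep x ≡ rep y

  transversal : ∀ {n} {_~_ : Rel (Fin n) 0ℓ} → IsEquivalence _~_ → (∀ x y → Dec (x ~ y)) → Transversal _~_
  transversal {n} {_~_} ~-equiv _~?_ = record { rep = rep ; rep-~ = rep-~ ; rep-cong = rep-cong }
    where
    open IsEquivalence ~-equiv renaming (refl to ~-refl; sym to ~-sym; trans to ~-trans)
    least : ∀ x → ∃ λ y → x ~ y × (∀ {z} → x ~ z → toℕ y ≤ toℕ z)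
    least x = minimum (x ~?_) ~-refl
    rep : Fin n → Fin n
    rep x = proj₁ (least x)
    rep-~ : ∀ x → x ~ rep x
    rep-~ x = proj₁ (proj₂ (least x))
    rep-cong : ∀ {x y} → x ~ y → rep x ≡ rep y
    rep-cong {x} {y} x~y = toℕ-injective (≤-antisym
      (proj₂ (proj₂ (least x)) (~-trans x~y (rep-~ y)))
      (proj₂ (proj₂ (least y)) (~-trans (~-sym x~y) (rep-~ x))))

open Counting

module GroupTheory (G : FinGroup) where

  open FinGroup G public
  open IsGroup isGroup public using (assoc; identityˡ; identityʳ; inverseˡ; inverseʳ)
  open ≡-Reasoning

  private
    group : Group 0ℓ 0ℓ
    group = record { isGroup = isGroup }

  open GroupProperties group public
    using (∙-cancelˡ; ∙-cancelʳ; ⁻¹-involutive; ⁻¹-anti-homo-∙; ε⁻¹≈ε; inverseʳ-unique; \\-leftDividesˡ; \\-leftDividesʳ; //-rightDividesˡ; //-rightDividesʳ)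

  infix 4 _≟_
  _≟_ : DecidableEquality Carrier
  _≟_ = _≟ᶠ_

  inv·≡e⇒≡ : ∀ {x y} → inv x · y ≡ e → x ≡ y
  inv·≡e⇒≡ {x} {y} eq = trans (sym (⁻¹-involutive x)) (sym (inverseʳ-unique (inv x) y eq))

  infixr 30 _^ᵍ_
  _^ᵍ_ : Carrier → ℕ → Carrier
  x ^ᵍ k = pow G x k

  ^ᵍ-+ : ∀ x a b → x ^ᵍ (a + b) ≡ x ^ᵍ a · x ^ᵍ b
  ^ᵍ-+ x zero    b = sym (identityˡ _)
  ^ᵍ-+ x (suc a) b = trans (cong (x ·_) (^ᵍ-+ x a b)) (sym (assoc _ _ _))

  ^ᵍ-* : ∀ x a b → x ^ᵍ (a * b) ≡ (x ^ᵍ a) ^ᵍ b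
  ^ᵍ-* x a zero    = cong (x ^ᵍ_) (*-zeroʳ a)
  ^ᵍ-* x a (suc b) = begin
    x ^ᵍ (a * suc b)             ≡⟨ cong (x ^ᵍ_) (*-suc a b) ⟩
    x ^ᵍ (a + a * b)             ≡⟨ ^ᵍ-+ x a (a * b) ⟩
    x ^ᵍ a · x ^ᵍ (a * b)        ≡⟨ cong (x ^ᵍ a ·_) (^ᵍ-* x a b) ⟩
    x ^ᵍ a · (x ^ᵍ a) ^ᵍ b       ∎

  e^ᵍ : ∀ k → e ^ᵍ k ≡ e
  e^ᵍ zero    = refl
  e^ᵍ (suc k) = trans (identityˡ _) (e^ᵍ k)

  ^ᵍ-1 : ∀ x → x ^ᵍ 1 ≡ x
  ^ᵍ-1 = identityʳ

  Commute : Carrier → Carrier → Set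
  Commute x y = x · y ≡ y · x

  ^ᵍ-commute : ∀ {x y} → Commute x y → ∀ k → Commute (x ^ᵍ k) y
  ^ᵍ-commute {x} {y} xy≡yx zero    = trans (identityˡ y) (sym (identityʳ y))
  ^ᵍ-commute {x} {y} xy≡yx (suc k) = begin
    (x · x ^ᵍ k) · y   ≡⟨ assoc _ _ _ ⟩
    x · (x ^ᵍ k · y)   ≡⟨ cong (x ·_) (^ᵍ-commute xy≡yx k) ⟩
    x · (y · x ^ᵍ k)   ≡⟨ sym (assoc _ _ _) ⟩
    (x · y) · x ^ᵍ k   ≡⟨ cong (_· x ^ᵍ k) xy≡yx ⟩
    (y · x) · x ^ᵍ k   ≡⟨ assoc _ _ _ ⟩
    y · (x · x ^ᵍ k)   ∎

  ·-^ᵍ : ∀ {x y} → Commute x y → ∀ k → (x · y) ^ᵍ k ≡ x ^ᵍ k · y ^ᵍ k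
  ·-^ᵍ {x} {y} xy≡yx zero    = sym (identityˡ e)
  ·-^ᵍ {x} {y} xy≡yx (suc k) = begin
    (x · y) · (x · y) ^ᵍ k           ≡⟨ cong ((x · y) ·_) (·-^ᵍ xy≡yx k) ⟩
    (x · y) · (x ^ᵍ k · y ^ᵍ k)      ≡⟨ assoc _ _ _ ⟩
    x · (y · (x ^ᵍ k · y ^ᵍ k))      ≡⟨ cong (x ·_) (sym (assoc _ _ _)) ⟩
    x · ((y · x ^ᵍ k) · y ^ᵍ k)      ≡⟨ cong (λ t → x · (t · y ^ᵍ k)) (sym (^ᵍ-commute xy≡yx k)) ⟩
    x · ((x ^ᵍ k · y) · y ^ᵍ k)      ≡⟨ cong (x ·_) (assoc _ _ _) ⟩
    x · (x ^ᵍ k · (y · y ^ᵍ k))      ≡⟨ sym (assoc _ _ _) ⟩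
    (x · x ^ᵍ k) · (y · y ^ᵍ k)      ∎

  inv-^ᵍ : ∀ x k → inv x ^ᵍ k ≡ inv (x ^ᵍ k)
  inv-^ᵍ x k = inverseʳ-unique (x ^ᵍ k) (inv x ^ᵍ k) (begin
    x ^ᵍ k · inv x ^ᵍ k   ≡⟨ sym (·-^ᵍ (trans (inverseʳ x) (sym (inverseˡ x))) k) ⟩
    (x · inv x) ^ᵍ k      ≡⟨ cong (_^ᵍ k) (inverseʳ x) ⟩
    e ^ᵍ k                ≡⟨ e^ᵍ k ⟩
    e                     ∎)

  Z : Carrier → Set
  Z = Center G

  Z? : Decidable Z
  Z? x = all? (λ y → x · y ≟ y · x)

  Z-e : Z e
  Z-e y = trans (identityˡ y) (sym (identityʳ y))

  Z-· : ∀ {x y} → Z x → Z y → Z (x · y)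
  Z-· {x} {y} x∈Z y∈Z g = begin
    (x · y) · g   ≡⟨ assoc _ _ _ ⟩
    x · (y · g)   ≡⟨ cong (x ·_) (y∈Z g) ⟩
    x · (g · y)   ≡⟨ sym (assoc _ _ _) ⟩
    (x · g) · y   ≡⟨ cong (_· y) (x∈Z g) ⟩
    (g · x) · y   ≡⟨ assoc _ _ _ ⟩
    g · (x · y)   ∎

  Z-inv : ∀ {x} → Z x → Z (inv x)
  Z-inv {x} x∈Z g = ∙-cancelˡ x _ _ (begin
    x · (inv x · g)     ≡⟨ \\-leftDividesˡ x g ⟩
    g                   ≡⟨ sym (//-rightDividesʳ x g) ⟩
    (g · x) · inv x     ≡⟨ cong (_· inv x) (sym (x∈Z g)) ⟩
    (x · g) · inv x     ≡⟨ assoc _ _ _ ⟩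
    x · (g · inv x)     ∎)

  Z-^ᵍ : ∀ {x} → Z x → ∀ k → Z (x ^ᵍ k)
  Z-^ᵍ x∈Z zero    = Z-e
  Z-^ᵍ x∈Z (suc k) = Z-· x∈Z (Z-^ᵍ x∈Z k)

  ⁅_,_⁆ : Carrier → Carrier → Carrier
  ⁅ x , y ⁆ = comm G x y

  comm-law : ∀ x y → x · y ≡ (y · x) · ⁅ x , y ⁆
  comm-law x y = sym (begin
    (y · x) · (inv x · (inv y · (x · y)))   ≡⟨ assoc _ _ _ ⟩
    y · (x · (inv x · (inv y · (x · y))))   ≡⟨ cong (y ·_) (\\-leftDividesˡ x _) ⟩
    y · (inv y · (x · y))                   ≡⟨ \\-leftDividesˡ y _ ⟩
    x · y                                   ∎)

  comm-unique : ∀ {x y w} → x · y ≡ (y · x) · w → ⁅ x , y ⁆ ≡ w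
  comm-unique {x} {y} eq = ∙-cancelˡ (y · x) _ _ (trans (sym (comm-law x y)) eq)

  commute⇒comm≡e : ∀ {x y} → Commute x y → ⁅ x , y ⁆ ≡ e
  commute⇒comm≡e xy≡yx = comm-unique (trans xy≡yx (sym (identityʳ _)))

  comm≡e⇒commute : ∀ {x y} → ⁅ x , y ⁆ ≡ e → Commute x y
  comm≡e⇒commute {x} {y} eq = trans (comm-law x y) (trans (cong ((y · x) ·_) eq) (identityʳ _))

  comm-flip : ∀ x y → ⁅ y , x ⁆ ≡ inv ⁅ x , y ⁆
  comm-flip x y = inverseʳ-unique _ _ (∙-cancelˡ (y · x) _ _ (begin
    (y · x) · (⁅ x , y ⁆ · ⁅ y , x ⁆)   ≡⟨ sym (assoc _ _ _) ⟩
    ((y · x) · ⁅ x , y ⁆) · ⁅ y , x ⁆   ≡⟨ cong (_· ⁅ y , x ⁆) (sym (comm-law x y)) ⟩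
    (x · y) · ⁅ y , x ⁆                 ≡⟨ sym (comm-law y x) ⟩
    y · x                               ≡⟨ sym (identityʳ _) ⟩
    (y · x) · e                         ∎))

  comm-centralˡ : ∀ {x} → Z x → ∀ y → ⁅ x , y ⁆ ≡ e
  comm-centralˡ x∈Z y = commute⇒comm≡e (x∈Z y)

  comm-centralʳ : ∀ {y} → Z y → ∀ x → ⁅ x , y ⁆ ≡ e
  comm-centralʳ y∈Z x = commute⇒comm≡e (sym (y∈Z x))

  nonabelian⇒noncommuting : Nonabelian G → ∃ λ a → ∃ λ b → ⁅ a , b ⁆ ≢ e
  nonabelian⇒noncommuting G-nonabelian =
    let (a , a∉Z) = ¬∀⟶∃¬ order Z Z? G-nonabelian
        (b , ab≢ba) = ¬∀⟶∃¬ order (λ b → a · b ≡ b · a) (λ b → a · b ≟ b · a) a∉Z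
    in a , b , ab≢ba ∘ comm≡e⇒commute

  inv[xy]·yx≡comm : ∀ x y → inv (x · y) · (y · x) ≡ ⁅ y , x ⁆
  inv[xy]·yx≡comm x y = trans (cong (_· (y · x)) (⁻¹-anti-homo-∙ x y)) (assoc _ _ _)

  module Class2 (comm-central : ∀ x y → Z ⁅ x , y ⁆) where

    comm-·ˡ : ∀ x x′ y → ⁅ x · x′ , y ⁆ ≡ ⁅ x , y ⁆ · ⁅ x′ , y ⁆
    comm-·ˡ x x′ y = comm-unique (begin
      (x · x′) · y                  ≡⟨ assoc _ _ _ ⟩
      x · (x′ · y)                  ≡⟨ cong (x ·_) (comm-law x′ y) ⟩
      x · ((y · x′) · c′)           ≡⟨ sym (assoc _ _ _) ⟩
      (x · (y · x′)) · c′           ≡⟨ cong (_· c′) (sym (assoc _ _ _)) ⟩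
      ((x · y) · x′) · c′           ≡⟨ cong (λ t → (t · x′) · c′) (comm-law x y) ⟩
      (((y · x) · c) · x′) · c′     ≡⟨ cong (_· c′) (assoc _ _ _) ⟩
      ((y · x) · (c · x′)) · c′     ≡⟨ cong (λ t → ((y · x) · t) · c′) (comm-central x y x′) ⟩
      ((y · x) · (x′ · c)) · c′     ≡⟨ cong (_· c′) (sym (assoc _ _ _)) ⟩
      (((y · x) · x′) · c) · c′     ≡⟨ assoc _ _ _ ⟩
      ((y · x) · x′) · (c · c′)     ≡⟨ cong (_· (c · c′)) (assoc _ _ _) ⟩
      (y · (x · x′)) · (c · c′)     ∎)
      where
      c  = ⁅ x , y ⁆
      c′ = ⁅ x′ , y ⁆

    comm-·ʳ : ∀ x y y′ → ⁅ x , y · y′ ⁆ ≡ ⁅ x , y ⁆ · ⁅ x , y′ ⁆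
    comm-·ʳ x y y′ = begin
      ⁅ x , y · y′ ⁆                        ≡⟨ comm-flip (y · y′) x ⟩
      inv ⁅ y · y′ , x ⁆                    ≡⟨ cong inv (comm-·ˡ y y′ x) ⟩
      inv (⁅ y , x ⁆ · ⁅ y′ , x ⁆)          ≡⟨ ⁻¹-anti-homo-∙ _ _ ⟩
      inv ⁅ y′ , x ⁆ · inv ⁅ y , x ⁆        ≡⟨ cong₂ _·_ (sym (comm-flip y′ x)) (sym (comm-flip y x)) ⟩
      ⁅ x , y′ ⁆ · ⁅ x , y ⁆                ≡⟨ comm-central x y′ ⁅ x , y ⁆ ⟩
      ⁅ x , y ⁆ · ⁅ x , y′ ⁆                ∎

    comm-invˡ : ∀ x y → ⁅ inv x , y ⁆ ≡ inv ⁅ x , y ⁆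
    comm-invˡ x y = inverseʳ-unique _ _ (begin
      ⁅ x , y ⁆ · ⁅ inv x , y ⁆   ≡⟨ comm-central x y _ ⟩
      ⁅ inv x , y ⁆ · ⁅ x , y ⁆   ≡⟨ sym (comm-·ˡ (inv x) x y) ⟩
      ⁅ inv x · x , y ⁆           ≡⟨ cong ⁅_, y ⁆ (inverseˡ x) ⟩
      ⁅ e , y ⁆                   ≡⟨ comm-centralˡ Z-e y ⟩
      e                           ∎)

    comm-^ᵍˡ : ∀ x y k → ⁅ x ^ᵍ k , y ⁆ ≡ ⁅ x , y ⁆ ^ᵍ k
    comm-^ᵍˡ x y zero    = comm-centralˡ Z-e y
    comm-^ᵍˡ x y (suc k) = trans (comm-·ˡ x (x ^ᵍ k) y) (cong (⁅ x , y ⁆ ·_) (comm-^ᵍˡ x y k))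

    comm-^ᵍʳ : ∀ x y k → ⁅ x , y ^ᵍ k ⁆ ≡ ⁅ x , y ⁆ ^ᵍ k
    comm-^ᵍʳ x y zero    = comm-centralʳ Z-e x
    comm-^ᵍʳ x y (suc k) = trans (comm-·ʳ x y (y ^ᵍ k)) (cong (⁅ x , y ⁆ ·_) (comm-^ᵍʳ x y k))

  record Subgroup : Set₁ where
    field
      member  : Carrier → Set
      member? : Decidable member
      e∈      : member e
      ·∈      : ∀ {x y} → member x → member y → member (x · y)
      inv∈    : ∀ {x} → member x → member (inv x)

    ^ᵍ∈ : ∀ {x} → member x → ∀ k → member (x ^ᵍ k)
    ^ᵍ∈ x∈ zero    = e∈
    ^ᵍ∈ x∈ (suc k) = ·∈ x∈ (^ᵍ∈ x∈ k)

    size : ℕ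
    size = count member?

  open Subgroup public using (member; member?; size)

  infix 4 _∈_ _⊆_
  _∈_ : Carrier → Subgroup → Set
  x ∈ S = member S x

  _⊆_ : Subgroup → Subgroup → Set
  S ⊆ T = ∀ {x} → x ∈ S → x ∈ T

  whole : Subgroup
  whole = record { member = U ; member? = U? ; e∈ = tt ; ·∈ = λ _ _ → tt ; inv∈ = λ _ → tt }

  size-whole : size whole ≡ order
  size-whole = count-U

  trivialSubgroup : Subgroup
  trivialSubgroup = record { member = _≡ e ; member? = _≟ e ; e∈ = refl ; ·∈ = λ { refl refl → identityˡ e } ; inv∈ = λ { refl → ε⁻¹≈ε } }

  centre : Subgroup
  centre = record { member = Z ; member? = Z? ; e∈ = Z-e ; ·∈ = Z-· ; inv∈ = Z-inv }

  central⇒normal : (S : Subgroup) → (∀ {x} → x ∈ S → Z x) → IsNormal G (member S)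
  central⇒normal S S⊆Z = record
    { N-e = e∈ ; N-mul = ·∈ ; N-inv = inv∈
    ; N-conj = λ {x} g x∈S → subst (_∈ S) (sym (trans (cong (inv g ·_) (S⊆Z x∈S g)) (\\-leftDividesʳ g x))) x∈S }
    where open Subgroup S using (e∈; ·∈; inv∈)

  Derived-^ᵍ : ∀ {c} → Derived G c → ∀ k → Derived G (c ^ᵍ k)
  Derived-^ᵍ c∈ zero    = gen-e
  Derived-^ᵍ c∈ (suc k) = gen-mul c∈ (Derived-^ᵍ c∈ k)

  Derived-minimal : (S : Subgroup) → (∀ x y → ⁅ x , y ⁆ ∈ S) → ∀ {c} → Derived G c → c ∈ S
  Derived-minimal S comm∈S gen-e                    = Subgroup.e∈ S
  Derived-minimal S comm∈S (gen-s (x , y , refl))   = comm∈S x y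
  Derived-minimal S comm∈S (gen-inv c∈)             = Subgroup.inv∈ S (Derived-minimal S comm∈S c∈)
  Derived-minimal S comm∈S (gen-mul c∈ c′∈)         = Subgroup.·∈ S (Derived-minimal S comm∈S c∈) (Derived-minimal S comm∈S c′∈)

  count-by-cosets : ∀ {m} (A K : Subgroup) → K ⊆ A → (φ : Carrier → Fin m) →
                    (∀ {a k} → k ∈ K → φ (a · k) ≡ φ a) →
                    (∀ {a a′} → a ∈ A → a′ ∈ A → φ a ≡ φ a′ → inv a · a′ ∈ K) →
                    size A ≡ size K * count (image? (member? A) φ)
  count-by-cosets A K K⊆A φ φ-const φ-coset =
    count-uniform-fibres (member? A) φ (λ {a} a∈A → sym (coset-size a∈A))
    where
    open Subgroup A using (·∈; inv∈)
    coset-size : ∀ {a} → a ∈ A → size K ≡ count (member? A ∩? (λ y → φ y ≟ᶠ φ a))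
    coset-size {a} a∈A = count-≡ (member? K) (member? A ∩? (λ y → φ y ≟ᶠ φ a))
      (a ·_) (λ k∈K → ·∈ a∈A (K⊆A k∈K) , φ-const k∈K) (λ _ _ → ∙-cancelˡ a _ _)
      (inv a ·_) (λ (y∈A , φy≡φa) → φ-coset a∈A y∈A (sym φy≡φa)) (λ _ _ → ∙-cancelˡ (inv a) _ _)

  coset-isEquivalence : ∀ {N : Carrier → Set} → N e → (∀ {x y} → N x → N y → N (x · y)) → (∀ {x} → N x → N (inv x)) →
                        IsEquivalence (λ a a′ → N (inv a · a′))
  coset-isEquivalence {N} N-e N-· N-inv = record
      { refl  = λ {a} → subst N (sym (inverseˡ a)) N-e
      ; sym   = λ {a} {a′} a~a′ → subst N (inv-flip a a′) (N-inv a~a′)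
      ; trans = λ {a} {a′} {a″} a~a′ a′~a″ → subst N (cancel-middle a a′ a″) (N-· a~a′ a′~a″)
      }
      where
      inv-flip : ∀ a a′ → inv (inv a · a′) ≡ inv a′ · a
      inv-flip a a′ = trans (⁻¹-anti-homo-∙ (inv a) a′) (cong (inv a′ ·_) (⁻¹-involutive a))
      cancel-middle : ∀ a a′ a″ → (inv a · a′) · (inv a′ · a″) ≡ inv a · a″
      cancel-middle a a′ a″ = trans (assoc _ _ _) (cong (inv a ·_) (\\-leftDividesˡ a′ a″))

  module Cosets (K : Subgroup) where
    open Subgroup K using (e∈; ·∈; inv∈)

    infix 4 _~_
    _~_ : Rel Carrier 0ℓ
    a ~ a′ = inv a · a′ ∈ K

    ~-isEquivalence : IsEquivalence _~_
    ~-isEquivalence = coset-isEquivalence {member K} e∈ ·∈ inv∈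

    open IsEquivalence ~-isEquivalence using () renaming (sym to ~-sym; trans to ~-trans)
    open Transversal (transversal ~-isEquivalence (λ a a′ → member? K (inv a · a′))) public

    rep-· : ∀ {a k} → k ∈ K → rep (a · k) ≡ rep a
    rep-· {a} {k} k∈K = sym (rep-cong (subst (_∈ K) (sym (\\-leftDividesʳ a k)) k∈K))

    rep≡⇒~ : ∀ {a a′} → rep a ≡ rep a′ → a ~ a′
    rep≡⇒~ {a} {a′} eq = ~-trans (rep-~ a) (subst (_~ a′) (sym eq) (~-sym (rep-~ a′)))

    lagrange : (A : Subgroup) → K ⊆ A → size A ≡ size K * count (image? (member? A) rep)
    lagrange A K⊆A = count-by-cosets A K K⊆A rep rep-· (λ _ _ → rep≡⇒~)

  size-∣ : (K A : Subgroup) → K ⊆ A → size K ∣ size A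
  size-∣ K A K⊆A = divides (count (image? (member? A) rep)) (trans (lagrange A K⊆A) (*-comm (size K) _))
    where open Cosets K

  private
    ^ᵍ-cancel : ∀ x a b → x ^ᵍ a ≡ x ^ᵍ (a + b) → x ^ᵍ b ≡ e
    ^ᵍ-cancel x a b eq = sym (∙-cancelˡ (x ^ᵍ a) _ _ (trans (identityʳ _) (trans eq (^ᵍ-+ x a b))))

    period : ∀ x → ∃ λ (i : Fin order) → x ^ᵍ suc (toℕ i) ≡ e
    period x with pigeonhole (n<1+n order) (λ (i : Fin (suc order)) → x ^ᵍ toℕ i)
    ... | i , j , i<j , xⁱ≡xʲ = fromℕ< d<order , (begin
      x ^ᵍ suc (toℕ (fromℕ< d<order))   ≡⟨ cong (λ t → x ^ᵍ suc t) (toℕ-fromℕ< d<order) ⟩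
      x ^ᵍ suc (toℕ j ∸ suc (toℕ i))    ≡⟨ cong (x ^ᵍ_) (sym (+-∸-assoc 1 i<j)) ⟩
      x ^ᵍ (toℕ j ∸ toℕ i)              ≡⟨ ^ᵍ-cancel x (toℕ i) _ (trans xⁱ≡xʲ (cong (x ^ᵍ_) (sym (m+[n∸m]≡n (<⇒≤ i<j))))) ⟩
      e                                 ∎)
      where
      d<order : toℕ j ∸ suc (toℕ i) < order
      d<order = <-≤-trans (∸-monoʳ-< {toℕ j} (s≤s z≤n) i<j) (≤-pred (toℕ<n j))

    least-period : ∀ x → ∃ λ (i : Fin order) → x ^ᵍ suc (toℕ i) ≡ e × (∀ {j} → x ^ᵍ suc (toℕ j) ≡ e → toℕ i ≤ toℕ j)
    least-period x = minimum (λ i → x ^ᵍ suc (toℕ i) ≟ e) {proj₁ (period x)} (proj₂ (period x))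

  opaque
    ord : Carrier → ℕ
    ord x = suc (toℕ (proj₁ (least-period x)))

    instance
      ord-nonZero : ∀ {x} → NonZero (ord x)
      ord-nonZero = _

    ^ᵍ-ord : ∀ x → x ^ᵍ ord x ≡ e
    ^ᵍ-ord x = proj₁ (proj₂ (least-period x))

    ord-minimal : ∀ x {m} .{{_ : NonZero m}} → x ^ᵍ m ≡ e → ord x ≤ m
    ord-minimal x {suc m} x^[1+m]≡e with m <? order
    ... | yes m<order = s≤s (subst (toℕ (proj₁ (least-period x)) ≤_) (toℕ-fromℕ< m<order)
            (proj₂ (proj₂ (least-period x)) (trans (cong (λ t → x ^ᵍ suc t) (toℕ-fromℕ< m<order)) x^[1+m]≡e)))
    ... | no  m≮order = ≤-trans (toℕ<n (proj₁ (least-period x))) (≤-trans (≮⇒≥ m≮order) (n≤1+n m))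

  ^ᵍ-%ord : ∀ x k → x ^ᵍ k ≡ x ^ᵍ (k % ord x)
  ^ᵍ-%ord x k = begin
    x ^ᵍ k                                   ≡⟨ cong (x ^ᵍ_) (m≡m%n+[m/n]*n k (ord x)) ⟩
    x ^ᵍ (k % ord x + k / ord x * ord x)      ≡⟨ ^ᵍ-+ x (k % ord x) _ ⟩
    x ^ᵍ (k % ord x) · x ^ᵍ (k / ord x * ord x) ≡⟨ cong (x ^ᵍ (k % ord x) ·_) x^[q*ord]≡e ⟩
    x ^ᵍ (k % ord x) · e                     ≡⟨ identityʳ _ ⟩
    x ^ᵍ (k % ord x)                         ∎
    where
    x^[q*ord]≡e : x ^ᵍ (k / ord x * ord x) ≡ e
    x^[q*ord]≡e = begin
      x ^ᵍ (k / ord x * ord x)   ≡⟨ cong (x ^ᵍ_) (*-comm (k / ord x) (ord x)) ⟩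
      x ^ᵍ (ord x * (k / ord x)) ≡⟨ ^ᵍ-* x (ord x) (k / ord x) ⟩
      (x ^ᵍ ord x) ^ᵍ (k / ord x) ≡⟨ cong (_^ᵍ (k / ord x)) (^ᵍ-ord x) ⟩
      e ^ᵍ (k / ord x)           ≡⟨ e^ᵍ (k / ord x) ⟩
      e                          ∎

  ord-∣ : ∀ x m → x ^ᵍ m ≡ e → ord x ∣ m
  ord-∣ x m x^m≡e = divides (m / ord x) (trans (m≡m%n+[m/n]*n m (ord x)) (cong (_+ m / ord x * ord x) remainder≡0))
    where
    remainder≡0 : m % ord x ≡ 0
    remainder≡0 with m % ord x in eq
    ... | zero  = refl
    ... | suc r = contradiction (ord-minimal x (trans (cong (x ^ᵍ_) (sym eq)) (trans (sym (^ᵍ-%ord x m)) x^m≡e)))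
                                (<⇒≱ (subst (_< ord x) eq (m%n<n m (ord x))))

  ord≡1⇒≡e : ∀ {x} → ord x ≡ 1 → x ≡ e
  ord≡1⇒≡e {x} ord≡1 = trans (sym (^ᵍ-1 x)) (trans (cong (x ^ᵍ_) (sym ord≡1)) (^ᵍ-ord x))

  Powers : Carrier → Carrier → Set
  Powers x g = ∃ λ (i : Fin (ord x)) → g ≡ x ^ᵍ toℕ i

  ^ᵍ∈Powers : ∀ x k → Powers x (x ^ᵍ k)
  ^ᵍ∈Powers x k = fromℕ< (m%n<n k (ord x)) , trans (^ᵍ-%ord x k) (cong (x ^ᵍ_) (sym (toℕ-fromℕ< (m%n<n k (ord x)))))

  ⟨_⟩ : Carrier → Subgroup
  ⟨ x ⟩ = record { member = Powers x ; member? = λ g → any? (λ i → g ≟ x ^ᵍ toℕ i) ; e∈ = ^ᵍ∈Powers x 0 ; ·∈ = ·∈ ; inv∈ = inv∈ }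
    where
    ·∈ : ∀ {g h} → Powers x g → Powers x h → Powers x (g · h)
    ·∈ (i , refl) (j , refl) = subst (Powers x) (^ᵍ-+ x (toℕ i) (toℕ j)) (^ᵍ∈Powers x (toℕ i + toℕ j))
    inv∈ : ∀ {g} → Powers x g → Powers x (inv g)
    inv∈ (i , refl) = subst (Powers x) (inverseʳ-unique _ _ (begin
      x ^ᵍ toℕ i · x ^ᵍ (ord x ∸ toℕ i)   ≡⟨ sym (^ᵍ-+ x (toℕ i) _) ⟩
      x ^ᵍ (toℕ i + (ord x ∸ toℕ i))      ≡⟨ cong (x ^ᵍ_) (m+[n∸m]≡n (<⇒≤ (toℕ<n i))) ⟩
      x ^ᵍ ord x                          ≡⟨ ^ᵍ-ord x ⟩
      e                                   ∎)) (^ᵍ∈Powers x (ord x ∸ toℕ i))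

  ^ᵍ∈⟨⟩ : ∀ x k → x ^ᵍ k ∈ ⟨ x ⟩
  ^ᵍ∈⟨⟩ = ^ᵍ∈Powers

  x∈⟨x⟩ : ∀ x → x ∈ ⟨ x ⟩
  x∈⟨x⟩ x = subst (_∈ ⟨ x ⟩) (^ᵍ-1 x) (^ᵍ∈⟨⟩ x 1)

  ⟨⟩-minimal : (S : Subgroup) → ∀ {x} → x ∈ S → ⟨ x ⟩ ⊆ S
  ⟨⟩-minimal S x∈S (i , refl) = Subgroup.^ᵍ∈ S x∈S (toℕ i)

  size-⟨⟩ : ∀ x → size ⟨ x ⟩ ≡ ord x
  size-⟨⟩ x = hasSize⇒count≡ (member? ⟨ x ⟩) ((λ i → x ^ᵍ toℕ i) , ^ᵍ-injective , (λ i → i , refl) , λ g (i , g≡xⁱ) → i , sym g≡xⁱ)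
    where
    ^ᵍ-injective< : ∀ (i j : Fin (ord x)) → toℕ i < toℕ j → x ^ᵍ toℕ i ≢ x ^ᵍ toℕ j
    ^ᵍ-injective< i j i<j xⁱ≡xʲ with toℕ j ∸ toℕ i in eq
    ... | zero  = <⇒≱ i<j (m∸n≡0⇒m≤n eq)
    ... | suc d = <⇒≱ (≤-<-trans (≤-trans (≤-reflexive (sym eq)) (m∸n≤m (toℕ j) (toℕ i))) (toℕ<n j))
                      (ord-minimal x (trans (cong (x ^ᵍ_) (sym eq)) (^ᵍ-cancel x (toℕ i) _ (trans xⁱ≡xʲ (cong (x ^ᵍ_) (sym (m+[n∸m]≡n (<⇒≤ i<j))))))))
    ^ᵍ-injective : ∀ i j → x ^ᵍ toℕ i ≡ x ^ᵍ toℕ j → i ≡ j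
    ^ᵍ-injective i j xⁱ≡xʲ with <-cmp (toℕ i) (toℕ j)
    ... | tri< i<j _ _ = contradiction xⁱ≡xʲ (^ᵍ-injective< i j i<j)
    ... | tri≈ _ i≡j _ = toℕ-injective i≡j
    ... | tri> _ _ j<i = contradiction (sym xⁱ≡xʲ) (^ᵍ-injective< j i j<i)

  ^ᵍ-ord-∈⟨⟩ : ∀ {x g} → g ∈ ⟨ x ⟩ → g ^ᵍ ord x ≡ e
  ^ᵍ-ord-∈⟨⟩ {x} (i , refl) = begin
    (x ^ᵍ toℕ i) ^ᵍ ord x     ≡⟨ sym (^ᵍ-* x (toℕ i) (ord x)) ⟩
    x ^ᵍ (toℕ i * ord x)     ≡⟨ cong (x ^ᵍ_) (*-comm (toℕ i) (ord x)) ⟩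
    x ^ᵍ (ord x * toℕ i)     ≡⟨ ^ᵍ-* x (ord x) (toℕ i) ⟩
    (x ^ᵍ ord x) ^ᵍ toℕ i    ≡⟨ cong (_^ᵍ toℕ i) (^ᵍ-ord x) ⟩
    e ^ᵍ toℕ i               ≡⟨ e^ᵍ (toℕ i) ⟩
    e                        ∎

  ord-∣-order : ∀ x → ord x ∣ order
  ord-∣-order x = subst₂ _∣_ (size-⟨⟩ x) size-whole (size-∣ ⟨ x ⟩ whole _)

  module Conjugacy where

    conjugate : Carrier → Carrier → Carrier
    conjugate g x = g · (x · inv g)

    conjugate-e : ∀ x → conjugate e x ≡ x
    conjugate-e x = trans (identityˡ _) (trans (cong (x ·_) ε⁻¹≈ε) (identityʳ x))

    conjugate-· : ∀ h g x → conjugate h (conjugate g x) ≡ conjugate (h · g) x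
    conjugate-· h g x = begin
      h · ((g · (x · inv g)) · inv h)     ≡⟨ cong (h ·_) (assoc _ _ _) ⟩
      h · (g · ((x · inv g) · inv h))     ≡⟨ sym (assoc _ _ _) ⟩
      (h · g) · ((x · inv g) · inv h)     ≡⟨ cong ((h · g) ·_) (assoc _ _ _) ⟩
      (h · g) · (x · (inv g · inv h))     ≡⟨ cong (λ t → (h · g) · (x · t)) (sym (⁻¹-anti-homo-∙ h g)) ⟩
      (h · g) · (x · inv (h · g))         ∎

    conjugate-inv : ∀ g x → conjugate (inv g) (conjugate g x) ≡ x
    conjugate-inv g x = trans (conjugate-· (inv g) g x) (trans (cong (λ t → conjugate t x) (inverseˡ g)) (conjugate-e x))

    conjugate≡⇒commute : ∀ {g x} → conjugate g x ≡ x → Commute g x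
    conjugate≡⇒commute {g} {x} eq = ∙-cancelʳ (inv g) _ _ (begin
      (g · x) · inv g   ≡⟨ assoc _ _ _ ⟩
      conjugate g x     ≡⟨ eq ⟩
      x                 ≡⟨ sym (trans (assoc _ _ _) (trans (cong (x ·_) (inverseʳ g)) (identityʳ x))) ⟩
      (x · g) · inv g   ∎)

    centraliser : Carrier → Subgroup
    centraliser x = record
      { member  = λ g → conjugate g x ≡ x
      ; member? = λ g → conjugate g x ≟ x
      ; e∈      = conjugate-e x
      ; ·∈      = λ {g} {h} gx≡x hx≡x → trans (sym (conjugate-· g h x)) (trans (cong (conjugate g) hx≡x) gx≡x)
      ; inv∈    = λ {g} gx≡x → trans (cong (conjugate (inv g)) (sym gx≡x)) (conjugate-inv g x)
      }

    ConjugacyClass : Carrier → Carrier → Set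
    ConjugacyClass x = Image U (λ g → conjugate g x)

    conjugacyClass? : ∀ x → Decidable (ConjugacyClass x)
    conjugacyClass? x = image? U? (λ g → conjugate g x)

    orbit-stabiliser : ∀ x → order ≡ size (centraliser x) * count (conjugacyClass? x)
    orbit-stabiliser x = trans (sym size-whole) (count-by-cosets whole (centraliser x) _ (λ g → conjugate g x)
      (λ {a} {k} kx≡x → trans (sym (conjugate-· a k x)) (cong (conjugate a) kx≡x))
      (λ {a} {a′} _ _ ax≡a′x → begin
        conjugate (inv a · a′) x              ≡⟨ sym (conjugate-· (inv a) a′ x) ⟩
        conjugate (inv a) (conjugate a′ x)    ≡⟨ cong (conjugate (inv a)) (sym ax≡a′x) ⟩
        conjugate (inv a) (conjugate a x)     ≡⟨ conjugate-inv a x ⟩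
        x                                     ∎))

    class-size≡1⇒central : ∀ {x} → count (conjugacyClass? x) ≡ 1 → Z x
    class-size≡1⇒central {x} size≡1 g = sym (conjugate≡⇒commute (trans
      (count≤1⇒unique (conjugacyClass? x) (≤-reflexive size≡1) (g , tt , refl) (e , tt , refl))
      (conjugate-e x)))

    _≈_ : Rel Carrier 0ℓ
    x ≈ y = ConjugacyClass x y

    ≈-isEquivalence : IsEquivalence _≈_
    ≈-isEquivalence = record
      { refl  = λ {x} → e , tt , conjugate-e x
      ; sym   = λ { {x} (g , _ , refl) → inv g , tt , conjugate-inv g x }
      ; trans = λ { {x} (g , _ , refl) (h , _ , refl) → h · g , tt , sym (conjugate-· h g x) }
      }

    open Transversal (transversal ≈-isEquivalence conjugacyClass?) public
      using () renaming (rep to classRep; rep-~ to classRep-≈; rep-cong to classRep-cong)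

    class-fibre? : ∀ j → Decidable (λ x → U x × classRep x ≡ j)
    class-fibre? j = U? ∩? (λ x → classRep x ≟ j)

    class-fibre : Carrier → ℕ
    class-fibre j = count (class-fibre? j)

    conjugate-central : ∀ {j} → Z j → ∀ g → conjugate g j ≡ j
    conjugate-central {j} j∈Z g = trans (cong (g ·_) (j∈Z (inv g))) (\\-leftDividesˡ g j)

    classRep-idempotent : ∀ x → classRep (classRep x) ≡ classRep x
    classRep-idempotent x = sym (classRep-cong (classRep-≈ x))

    central-fibre : ∀ {j} → Z j → class-fibre j ≡ 1
    central-fibre {j} j∈Z = trans (count-cong (class-fibre? j) (j ≟_) (fibre⊆j , j⊆fibre)) (count-singleton j)
      where
      fibre⊆j : ∀ {x} → U x × classRep x ≡ j → j ≡ x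
      fibre⊆j {x} (_ , refl) with classRep-≈ x
      ... | g , _ , gx≡j = trans (sym (conjugate-central j∈Z (inv g))) (trans (cong (conjugate (inv g)) (sym gx≡j)) (conjugate-inv g x))
      j⊆fibre : ∀ {x} → j ≡ x → U x × classRep x ≡ j
      j⊆fibre refl with classRep-≈ j
      ... | g , _ , gj≡rep = tt , trans (sym gj≡rep) (conjugate-central j∈Z g)

    non-rep-fibre : ∀ {j} → classRep j ≢ j → class-fibre j ≡ 0
    non-rep-fibre {j} rep-j≢j = count-∅ (class-fibre? j) (λ { x (_ , refl) → rep-j≢j (classRep-idempotent x) })

    rep-fibre : ∀ {j} → classRep j ≡ j → class-fibre j ≡ count (conjugacyClass? j)
    rep-fibre {j} rep-j≡j = count-cong (class-fibre? j) (conjugacyClass? j)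
      ( (λ { {x} (_ , refl) → IsEquivalence.sym ≈-isEquivalence (classRep-≈ x) })
      , (λ j≈x → tt , trans (sym (classRep-cong j≈x)) rep-j≡j) )

    order≡∑class-fibre : order ≡ sum class-fibre
    order≡∑class-fibre = trans (sym count-U) (count-∑-fibres U? classRep)

≅⇒order≡ : ∀ {H G} → H ≅ G → FinGroup.order H ≡ FinGroup.order G
≅⇒order≡ (f , _ , f-injective , f-onto) = ≤-antisym
  (injective⇒≤ (λ {a} {b} → f-injective a b))
  (injective⇒≤ {f = proj₁ ∘ f-onto} (λ {y} {y′} eq → trans (sym (proj₂ (f-onto y))) (trans (cong f eq) (proj₂ (f-onto y′)))))

module Quotient (G : FinGroup) (N : GroupTheory.Subgroup G) (N-normal : IsNormal G (GroupTheory.Subgroup.member N)) where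
  open GroupTheory G
  open Cosets N
  open IsNormal N-normal using (N-conj)
  open IsEquivalence ~-isEquivalence using () renaming (refl to ~-refl; sym to ~-sym; trans to ~-trans)
  open ≡-Reasoning

  ~-·ʳ : ∀ {a a′} b → a ~ a′ → (a · b) ~ (a′ · b)
  ~-·ʳ {a} {a′} b a~a′ = subst (_∈ N) (begin
    inv b · ((inv a · a′) · b)   ≡⟨ cong (inv b ·_) (assoc _ _ _) ⟩
    inv b · (inv a · (a′ · b))   ≡⟨ sym (assoc _ _ _) ⟩
    (inv b · inv a) · (a′ · b)   ≡⟨ cong (_· (a′ · b)) (sym (⁻¹-anti-homo-∙ a b)) ⟩
    inv (a · b) · (a′ · b)       ∎) (N-conj b a~a′)

  ~-·ˡ : ∀ b {a a′} → a ~ a′ → (b · a) ~ (b · a′)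
  ~-·ˡ b {a} {a′} a~a′ = subst (_∈ N) (begin
    inv a · a′                   ≡⟨ cong (inv a ·_) (sym (\\-leftDividesʳ b a′)) ⟩
    inv a · (inv b · (b · a′))   ≡⟨ sym (assoc _ _ _) ⟩
    (inv a · inv b) · (b · a′)   ≡⟨ cong (_· (b · a′)) (sym (⁻¹-anti-homo-∙ b a)) ⟩
    inv (b · a) · (b · a′)       ∎) a~a′

  ~-· : ∀ {a a′ b b′} → a ~ a′ → b ~ b′ → (a · b) ~ (a′ · b′)
  ~-· {a′ = a′} {b = b} a~a′ b~b′ = ~-trans (~-·ʳ b a~a′) (~-·ˡ a′ b~b′)

  IsRep : Carrier → Set
  IsRep g = rep g ≡ g

  r : ℕ
  r = count (λ g → rep g ≟ g)

  private
    enumeration : HasSize IsRep r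
    enumeration = count-hasSize (λ g → rep g ≟ g)

  lift : Fin r → Carrier
  lift = proj₁ enumeration

  lift-injective : ∀ i j → lift i ≡ lift j → i ≡ j
  lift-injective = proj₁ (proj₂ enumeration)

  lift-rep : ∀ i → IsRep (lift i)
  lift-rep = proj₁ (proj₂ (proj₂ enumeration))

  private
    rep-index : ∀ g → ∃ λ i → lift i ≡ rep g
    rep-index g = proj₂ (proj₂ (proj₂ enumeration)) (rep g) (sym (rep-cong (rep-~ g)))

  ⟦_⟧ : Carrier → Fin r
  ⟦ g ⟧ = proj₁ (rep-index g)

  lift-⟦⟧ : ∀ g → lift ⟦ g ⟧ ~ g
  lift-⟦⟧ g = subst (_~ g) (sym (proj₂ (rep-index g))) (~-sym (rep-~ g))

  ⟦⟧-cong : ∀ {a a′} → a ~ a′ → ⟦ a ⟧ ≡ ⟦ a′ ⟧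
  ⟦⟧-cong {a} {a′} a~a′ = lift-injective _ _ (trans (proj₂ (rep-index a)) (trans (rep-cong a~a′) (sym (proj₂ (rep-index a′)))))

  ⟦⟧-injective : ∀ {a a′} → ⟦ a ⟧ ≡ ⟦ a′ ⟧ → a ~ a′
  ⟦⟧-injective {a} {a′} eq = ~-trans (~-sym (lift-⟦⟧ a)) (subst (λ i → lift i ~ a′) (sym eq) (lift-⟦⟧ a′))

  ⟦lift⟧ : ∀ i → ⟦ lift i ⟧ ≡ i
  ⟦lift⟧ i = lift-injective _ _ (trans (proj₂ (rep-index (lift i))) (lift-rep i))

  _·Q_ : Fin r → Fin r → Fin r
  i ·Q j = ⟦ lift i · lift j ⟧

  eQ : Fin r
  eQ = ⟦ e ⟧

  invQ : Fin r → Fin r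
  invQ i = ⟦ inv (lift i) ⟧

  ⟦⟧-·ˡ : ∀ a j → ⟦ lift ⟦ a ⟧ · lift j ⟧ ≡ ⟦ a · lift j ⟧
  ⟦⟧-·ˡ a j = ⟦⟧-cong (~-·ʳ (lift j) (lift-⟦⟧ a))

  ⟦⟧-·ʳ : ∀ i a → ⟦ lift i · lift ⟦ a ⟧ ⟧ ≡ ⟦ lift i · a ⟧
  ⟦⟧-·ʳ i a = ⟦⟧-cong (~-·ˡ (lift i) (lift-⟦⟧ a))

  Q : FinGroup
  Q = record
    { order = r
    ; _·_ = _·Q_
    ; e = eQ
    ; inv = invQ
    ; isGroup = record
      { isMonoid = record
        { isSemigroup = record
          { isMagma = record { isEquivalence = isEquivalence ; ∙-cong = cong₂ _·Q_ }
          ; assoc = λ i j k → trans (⟦⟧-·ˡ (lift i · lift j) k)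
                                   (trans (cong ⟦_⟧ (assoc _ _ _)) (sym (⟦⟧-·ʳ i (lift j · lift k))))
          }
        ; identity = (λ i → trans (⟦⟧-·ˡ e i) (trans (cong ⟦_⟧ (identityˡ _)) (⟦lift⟧ i)))
                   , (λ i → trans (⟦⟧-·ʳ i e) (trans (cong ⟦_⟧ (identityʳ _)) (⟦lift⟧ i)))
        }
      ; inverse = (λ i → trans (⟦⟧-·ˡ (inv (lift i)) i) (cong ⟦_⟧ (inverseˡ _)))
                , (λ i → trans (⟦⟧-·ʳ i (inv (lift i))) (cong ⟦_⟧ (inverseʳ _)))
      ; ⁻¹-cong = cong invQ
      }
    }

  lift-~-injective : ∀ i j → lift i ~ lift j → i ≡ j
  lift-~-injective i j lift-i~lift-j = trans (sym (⟦lift⟧ i)) (trans (⟦⟧-cong lift-i~lift-j) (⟦lift⟧ j))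

  quotientSize : QuotientSize G (member N) r
  quotientSize = lift , lift-~-injective , λ g → ⟦ g ⟧ , lift-⟦⟧ g

  Q≼G : Q ≼ G
  Q≼G = member N , N-normal , lift , (λ i j → lift-⟦⟧ (lift i · lift j)) , lift-~-injective , λ g → ⟦ g ⟧ , lift-⟦⟧ g

  order≡size*r : order ≡ size N * r
  order≡size*r = begin
    order                                   ≡⟨ sym size-whole ⟩
    size whole                              ≡⟨ lagrange whole _ ⟩
    size N * count (image? U? rep)          ≡⟨ cong (size N *_) (count-cong (image? U? rep) (λ g → rep g ≟ g) (image⊆IsRep , IsRep⊆image)) ⟩
    size N * r                              ∎
    where
    image⊆IsRep : ∀ {g} → Image _ rep g → IsRep g
    image⊆IsRep (a , _ , refl) = sym (rep-cong (rep-~ a))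
    IsRep⊆image : ∀ {g} → IsRep g → Image _ rep g
    IsRep⊆image {g} rep-g≡g = g , _ , rep-g≡g

  r∣order : r ∣ order
  r∣order = divides (size N) order≡size*r

  nontrivial⇒r<order : ∀ {x} → x ∈ N → x ≢ e → r < order
  nontrivial⇒r<order {x} x∈N x≢e = subst (r <_) (sym (trans order≡size*r (*-comm (size N) r)))
    (m<m*n r (size N) {{r-nonZero}} (≢⇒2≤count (member? N) (Subgroup.e∈ N) x∈N (x≢e ∘ sym)))
    where
    r-nonZero : NonZero r
    r-nonZero = >-nonZero (∈⇒0<count (λ g → rep g ≟ g) (sym (rep-cong (rep-~ e))))

  Q-abelian⇒comm∈N : Abelian Q → ∀ a b → ⁅ a , b ⁆ ∈ N
  Q-abelian⇒comm∈N Q-abelian a b = subst (_∈ N) (inv[xy]·yx≡comm b a) (⟦⟧-injective (begin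
    ⟦ b · a ⟧                     ≡⟨ sym (⟦⟧-cong (~-· (lift-⟦⟧ b) (lift-⟦⟧ a))) ⟩
    ⟦ b ⟧ ·Q ⟦ a ⟧                ≡⟨ Q-abelian ⟦ b ⟧ ⟦ a ⟧ ⟩
    ⟦ a ⟧ ·Q ⟦ b ⟧                ≡⟨ ⟦⟧-cong (~-· (lift-⟦⟧ a) (lift-⟦⟧ b)) ⟩
    ⟦ a · b ⟧                     ∎))

module PrimeOrder (G : FinGroup) {p : ℕ} (p-prime : Prime p) where
  open GroupTheory G
  open ≡-Reasoning

  private
    instance
      p-nonZero : NonZero p
      p-nonZero = prime⇒nonZero p-prime

    1<p : 1 < p
    1<p = prime⇒1<p p-prime

  ord∣p⇒ord≡p : ∀ {w} → w ≢ e → ord w ∣ p → ord w ≡ p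
  ord∣p⇒ord≡p w≢e ord∣p = [ (λ ord≡1 → contradiction (ord≡1⇒≡e ord≡1) w≢e) , id ]′ (prime⇒irreducible p-prime ord∣p)

  ord≡p : ∀ {w} → w ≢ e → w ^ᵍ p ≡ e → ord w ≡ p
  ord≡p {w} w≢e w^p≡e = ord∣p⇒ord≡p w≢e (ord-∣ w p w^p≡e)

  ord≡p⇒≢e : ∀ {w} → ord w ≡ p → w ≢ e
  ord≡p⇒≢e ord≡p refl = <⇒≱ 1<p (subst (_≤ 1) ord≡p (ord-minimal e (identityʳ e)))

  ord≡p⇒^ᵍp≡e : ∀ {w} → ord w ≡ p → w ^ᵍ p ≡ e
  ord≡p⇒^ᵍp≡e {w} ord≡p = subst (λ n → w ^ᵍ n ≡ e) ord≡p (^ᵍ-ord w)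

  ⟨⟩-order-p : ∀ {y w} → ord y ≡ p → w ∈ ⟨ y ⟩ → w ≢ e → ⟨ y ⟩ ⊆ ⟨ w ⟩
  ⟨⟩-order-p {y} {w} ord-y≡p w∈⟨y⟩ w≢e =
    count-≥⇒⊇ (member? ⟨ w ⟩) (member? ⟨ y ⟩) (⟨⟩-minimal ⟨ y ⟩ w∈⟨y⟩) (≤-reflexive (begin
      size ⟨ y ⟩   ≡⟨ size-⟨⟩ y ⟩
      ord y        ≡⟨ ord-y≡p ⟩
      p            ≡⟨ sym (ord≡p w≢e (subst (λ n → w ^ᵍ n ≡ e) ord-y≡p (^ᵍ-ord-∈⟨⟩ w∈⟨y⟩))) ⟩
      ord w        ≡⟨ sym (size-⟨⟩ w) ⟩
      size ⟨ w ⟩   ∎))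

  ord-^ᵍp^a : ∀ {x} a → ord x ≡ p ^ suc a → ord (x ^ᵍ (p ^ a)) ≡ p
  ord-^ᵍp^a {x} a ord≡p^[1+a] = ord≡p w≢e (begin
    (x ^ᵍ (p ^ a)) ^ᵍ p   ≡⟨ sym (^ᵍ-* x (p ^ a) p) ⟩
    x ^ᵍ (p ^ a * p)      ≡⟨ cong (x ^ᵍ_) (trans (*-comm (p ^ a) p) (sym ord≡p^[1+a])) ⟩
    x ^ᵍ ord x            ≡⟨ ^ᵍ-ord x ⟩
    e                     ∎)
    where
    w≢e : x ^ᵍ (p ^ a) ≢ e
    w≢e w≡e = <⇒≱ (subst (p ^ a <_) (trans (*-comm (p ^ a) p) (sym ord≡p^[1+a])) (m<m*n (p ^ a) p {{m^n≢0 p a}} 1<p))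
                  (ord-minimal x {{m^n≢0 p a}} w≡e)

  ⟨⟩-socle : ∀ {z a w} → ord z ≡ p ^ suc a → w ∈ ⟨ z ⟩ → w ^ᵍ p ≡ e → w ∈ ⟨ z ^ᵍ (p ^ a) ⟩
  ⟨⟩-socle {z} {a} ord-z≡p^[1+a] (i , refl) w^p≡e = from-divisor p^a∣i
    where
    p^a∣i : p ^ a ∣ toℕ i
    p^a∣i = *-cancelʳ-∣ p (subst (_∣ toℕ i * p) (trans ord-z≡p^[1+a] (*-comm p (p ^ a)))
                                 (ord-∣ z (toℕ i * p) (trans (^ᵍ-* z (toℕ i) p) w^p≡e)))
    from-divisor : p ^ a ∣ toℕ i → z ^ᵍ toℕ i ∈ ⟨ z ^ᵍ (p ^ a) ⟩
    from-divisor (divides q i≡q*p^a) = subst (_∈ ⟨ z ^ᵍ (p ^ a) ⟩) (begin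
      (z ^ᵍ (p ^ a)) ^ᵍ q   ≡⟨ sym (^ᵍ-* z (p ^ a) q) ⟩
      z ^ᵍ (p ^ a * q)      ≡⟨ cong (z ^ᵍ_) (trans (*-comm (p ^ a) q) (sym i≡q*p^a)) ⟩
      z ^ᵍ toℕ i            ∎) (^ᵍ∈⟨⟩ (z ^ᵍ (p ^ a)) q)

module PGroup (G : FinGroup) {p : ℕ} (p-prime : Prime p) (G-p : IsPGroup p G) where
  open GroupTheory G
  open PrimeOrder G p-prime
  open ≡-Reasoning

  private
    k : ℕ
    k = proj₁ G-p
    order≡p^k : order ≡ p ^ k
    order≡p^k = proj₂ G-p

  size-p-power : (S : Subgroup) → ∃ λ i → size S ≡ p ^ i
  size-p-power S = ∣p^k⇒≡p^i p-prime k (subst (size S ∣_) (trans size-whole order≡p^k) (size-∣ S whole _))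

  ord-p-power : ∀ x → ∃ λ i → ord x ≡ p ^ i
  ord-p-power x = ∣p^k⇒≡p^i p-prime k (subst (ord x ∣_) order≡p^k (ord-∣-order x))

  power-of-order-p : ∀ {x} → x ≢ e → ∃ λ m → ord (x ^ᵍ m) ≡ p
  power-of-order-p {x} x≢e = go (ord-p-power x)
    where
    go : (∃ λ i → ord x ≡ p ^ i) → ∃ λ m → ord (x ^ᵍ m) ≡ p
    go (zero  , ord≡1)       = contradiction (ord≡1⇒≡e ord≡1) x≢e
    go (suc a , ord≡p^[1+a]) = p ^ a , ord-^ᵍp^a a ord≡p^[1+a]

  p∣order : ∀ {x} → x ≢ e → p ∣ order
  p∣order {x} x≢e = from-exponent k order≡p^k
    where
    from-exponent : ∀ i → order ≡ p ^ i → p ∣ order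
    from-exponent zero    order≡1       = contradiction (count≤1⇒unique U? (≤-reflexive (trans count-U order≡1)) {x} {e} tt tt) x≢e
    from-exponent (suc i) order≡p^[1+i] = divides (p ^ i) (trans order≡p^[1+i] (*-comm p (p ^ i)))

  open Conjugacy

  private
    class-size-p-power : ∀ x → ∃ λ i → count (conjugacyClass? x) ≡ p ^ i
    class-size-p-power x = ∣p^k⇒≡p^i p-prime k (divides (size (centraliser x)) (trans (sym order≡p^k) (orbit-stabiliser x)))

    p∣noncentral-class : ∀ {j} → ¬ Z j → p ∣ count (conjugacyClass? j)
    p∣noncentral-class {j} j∉Z = go (class-size-p-power j)
      where
      go : (∃ λ i → count (conjugacyClass? j) ≡ p ^ i) → p ∣ count (conjugacyClass? j)
      go (zero  , size≡1)         = contradiction (class-size≡1⇒central size≡1) j∉Z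
      go (suc i , size≡p^[1+i])   = divides (p ^ i) (trans size≡p^[1+i] (*-comm p (p ^ i)))

    class-fibre-decomposition : ∀ j → ∃ λ rest → p ∣ rest × class-fibre j ≡ indicator (Z? j) + rest
    class-fibre-decomposition j = decomposition (Z? j)
      where
      decomposition : (j∈Z? : Dec (Z j)) → ∃ λ rest → p ∣ rest × class-fibre j ≡ indicator j∈Z? + rest
      decomposition (yes j∈Z) = 0 , p ∣0 , central-fibre j∈Z
      decomposition (no  j∉Z) = class-fibre j , p∣fibre (classRep j ≟ j) , refl
        where
        p∣fibre : Dec (classRep j ≡ j) → p ∣ class-fibre j
        p∣fibre (yes rep-j≡j) = subst (p ∣_) (sym (rep-fibre rep-j≡j)) (p∣noncentral-class j∉Z)
        p∣fibre (no  rep-j≢j) = subst (p ∣_) (sym (non-rep-fibre rep-j≢j)) (p ∣0)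

  private
    noncentral-part : Carrier → ℕ
    noncentral-part j = proj₁ (class-fibre-decomposition j)

    class-equation : order ≡ sum noncentral-part + size centre
    class-equation = begin
      order                                            ≡⟨ order≡∑class-fibre ⟩
      sum class-fibre                                  ≡⟨ sum-cong-≗ (proj₂ ∘ proj₂ ∘ class-fibre-decomposition) ⟩
      sum (λ j → indicator (Z? j) + noncentral-part j) ≡⟨ ∑-distrib-+ (indicator ∘ Z?) noncentral-part ⟩
      size centre + sum noncentral-part                ≡⟨ +-comm (size centre) (sum noncentral-part) ⟩
      sum noncentral-part + size centre                ∎

  p∣size-centre : ∀ {x} → x ≢ e → p ∣ size centre
  p∣size-centre x≢e = ∣m+n∣m⇒∣n (subst (p ∣_) class-equation (p∣order x≢e)) (∣-sum noncentral-part (proj₁ ∘ proj₂ ∘ class-fibre-decomposition))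

  centre-nontrivial : ∀ {x} → x ≢ e → ∃ λ z → Z z × z ≢ e
  centre-nontrivial x≢e = 2≤count⇒∃≢ Z? (≤-trans p≥2 p≤size) e
    where
    p≥2 : 2 ≤ p
    p≥2 = prime⇒1<p p-prime
    instance
      size-nonZero : NonZero (size centre)
      size-nonZero = >-nonZero (∈⇒0<count Z? Z-e)
    p≤size : p ≤ size centre
    p≤size = ∣⇒≤ (p∣size-centre x≢e)

  module _ (S : Subgroup) (S-abelian : ∀ {x y} → x ∈ S → y ∈ S → Commute x y) where
    open Subgroup S using (·∈; inv∈; ^ᵍ∈)

    private
      module _ {z : Carrier} (z∈S : z ∈ S) (a : ℕ)
               (socle : ∀ {w} → w ∈ S → w ^ᵍ p ≡ e → ∃ λ j → w ≡ z ^ᵍ (p ^ a * j)) where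

        descent : ∀ b c → c + b ≡ suc a → ∀ {x} → x ∈ S → x ^ᵍ (p ^ b) ≡ e → ∃ λ i → x ≡ z ^ᵍ (p ^ c * i)
        descent zero    c _ {x} _ x¹≡e = 0 , (begin
          x                   ≡⟨ sym (^ᵍ-1 x) ⟩
          x ^ᵍ 1              ≡⟨ x¹≡e ⟩
          e                   ≡⟨ cong (z ^ᵍ_) (sym (*-zeroʳ (p ^ c))) ⟩
          z ^ᵍ (p ^ c * 0)    ∎)
        descent (suc b) c c+[1+b]≡1+a {x} x∈S x^p^[1+b]≡e = p ^ b * j + i , (begin
          x                                     ≡⟨ sym (trans (assoc _ _ _) (trans (cong (x ·_) (inverseˡ v)) (identityʳ x))) ⟩
          w · v                                 ≡⟨ cong (_· v) w≡z^[p^a*j] ⟩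
          z ^ᵍ (p ^ a * j) · z ^ᵍ (p ^ c * i)   ≡⟨ sym (^ᵍ-+ z (p ^ a * j) (p ^ c * i)) ⟩
          z ^ᵍ (p ^ a * j + p ^ c * i)          ≡⟨ cong (z ^ᵍ_) exponent ⟩
          z ^ᵍ (p ^ c * (p ^ b * j + i))        ∎)
          where
          c+b≡a : c + b ≡ a
          c+b≡a = cong pred (trans (sym (+-suc c b)) c+[1+b]≡1+a)
          IH : ∃ λ i → x ^ᵍ p ≡ z ^ᵍ (p ^ suc c * i)
          IH = descent b (suc c) (cong suc c+b≡a) (^ᵍ∈ x∈S p) (trans (sym (^ᵍ-* x p (p ^ b))) x^p^[1+b]≡e)
          i : ℕ
          i = proj₁ IH
          v : Carrier
          v = z ^ᵍ (p ^ c * i)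
          v∈S : v ∈ S
          v∈S = ^ᵍ∈ z∈S (p ^ c * i)
          v^p≡x^p : v ^ᵍ p ≡ x ^ᵍ p
          v^p≡x^p = begin
            (z ^ᵍ (p ^ c * i)) ^ᵍ p   ≡⟨ sym (^ᵍ-* z (p ^ c * i) p) ⟩
            z ^ᵍ (p ^ c * i * p)      ≡⟨ cong (z ^ᵍ_) (trans (*-comm (p ^ c * i) p) (sym (*-assoc p (p ^ c) i))) ⟩
            z ^ᵍ (p ^ suc c * i)      ≡⟨ sym (proj₂ IH) ⟩
            x ^ᵍ p                    ∎
          w : Carrier
          w = x · inv v
          w^p≡e : w ^ᵍ p ≡ e
          w^p≡e = begin
            (x · inv v) ^ᵍ p          ≡⟨ ·-^ᵍ (S-abelian x∈S (inv∈ v∈S)) p ⟩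
            x ^ᵍ p · inv v ^ᵍ p       ≡⟨ cong (x ^ᵍ p ·_) (trans (inv-^ᵍ v p) (cong inv v^p≡x^p)) ⟩
            x ^ᵍ p · inv (x ^ᵍ p)     ≡⟨ inverseʳ _ ⟩
            e                         ∎
          j : ℕ
          j = proj₁ (socle (·∈ x∈S (inv∈ v∈S)) w^p≡e)
          w≡z^[p^a*j] : w ≡ z ^ᵍ (p ^ a * j)
          w≡z^[p^a*j] = proj₂ (socle (·∈ x∈S (inv∈ v∈S)) w^p≡e)
          exponent : p ^ a * j + p ^ c * i ≡ p ^ c * (p ^ b * j + i)
          exponent = begin
            p ^ a * j + p ^ c * i               ≡⟨ cong (λ t → p ^ t * j + p ^ c * i) (sym c+b≡a) ⟩
            p ^ (c + b) * j + p ^ c * i         ≡⟨ cong (λ t → t * j + p ^ c * i) (^-distribˡ-+-* p c b) ⟩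
            p ^ c * p ^ b * j + p ^ c * i       ≡⟨ cong (_+ p ^ c * i) (*-assoc (p ^ c) (p ^ b) j) ⟩
            p ^ c * (p ^ b * j) + p ^ c * i     ≡⟨ sym (*-distribˡ-+ (p ^ c) (p ^ b * j) i) ⟩
            p ^ c * (p ^ b * j + i)             ∎

    unique-order-p⇒cyclic : ∀ {y} → y ∈ S → ord y ≡ p → (∀ {w} → w ∈ S → w ^ᵍ p ≡ e → w ∈ ⟨ y ⟩) →
                            ∃ λ z → z ∈ S × (∀ {x} → x ∈ S → ∃ λ n → x ≡ z ^ᵍ n)
    unique-order-p⇒cyclic {y} y∈S ord-y≡p order-p⊆⟨y⟩ = from-exponent (ord-p-power z)
      where
      maximal : ∃ λ z → z ∈ S × (∀ {x} → x ∈ S → ord x ≤ ord z)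
      maximal = maximum (member? S) ord y∈S
      z : Carrier
      z = proj₁ maximal
      z∈S : z ∈ S
      z∈S = proj₁ (proj₂ maximal)
      ord≤ord-z : ∀ {x} → x ∈ S → ord x ≤ ord z
      ord≤ord-z = proj₂ (proj₂ maximal)

      from-exponent : (∃ λ i → ord z ≡ p ^ i) → ∃ λ z → z ∈ S × (∀ {x} → x ∈ S → ∃ λ n → x ≡ z ^ᵍ n)
      from-exponent (zero , ord-z≡1) = contradiction (subst₂ _≤_ ord-y≡p ord-z≡1 (ord≤ord-z y∈S)) (<⇒≱ (prime⇒1<p p-prime))
      from-exponent (suc a , ord-z≡p^[1+a]) = z , z∈S , generated
        where
        ord-u≡p : ord (z ^ᵍ (p ^ a)) ≡ p
        ord-u≡p = ord-^ᵍp^a a ord-z≡p^[1+a]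
        ⟨y⟩⊆⟨u⟩ : ⟨ y ⟩ ⊆ ⟨ z ^ᵍ (p ^ a) ⟩
        ⟨y⟩⊆⟨u⟩ = ⟨⟩-order-p ord-y≡p (order-p⊆⟨y⟩ (^ᵍ∈ z∈S (p ^ a)) (ord≡p⇒^ᵍp≡e ord-u≡p)) (ord≡p⇒≢e ord-u≡p)
        socle : ∀ {w} → w ∈ S → w ^ᵍ p ≡ e → ∃ λ j → w ≡ z ^ᵍ (p ^ a * j)
        socle w∈S w^p≡e =
          let (j , w≡u^j) = ⟨y⟩⊆⟨u⟩ (order-p⊆⟨y⟩ w∈S w^p≡e)
          in toℕ j , trans w≡u^j (sym (^ᵍ-* z (p ^ a) (toℕ j)))
        generated : ∀ {x} → x ∈ S → ∃ λ n → x ≡ z ^ᵍ n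
        generated {x} x∈S = from-order (ord-p-power x)
          where
          from-order : (∃ λ b → ord x ≡ p ^ b) → ∃ λ n → x ≡ z ^ᵍ n
          from-order (b , ord-x≡p^b) = p ^ (suc a ∸ b) * proj₁ descended , proj₂ descended
            where
            b≤1+a : b ≤ suc a
            b≤1+a = ^-cancelʳ-≤ (prime⇒1<p p-prime) (subst₂ _≤_ ord-x≡p^b ord-z≡p^[1+a] (ord≤ord-z x∈S))
            x^p^b≡e : x ^ᵍ (p ^ b) ≡ e
            x^p^b≡e = subst (λ t → x ^ᵍ t ≡ e) ord-x≡p^b (^ᵍ-ord x)
            descended : ∃ λ i → x ≡ z ^ᵍ (p ^ (suc a ∸ b) * i)
            descended = descent z∈S a socle b (suc a ∸ b) (m∸n+n≡m b≤1+a) x∈S x^p^b≡e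

module Symplectic (G : FinGroup) {p : ℕ} (p-prime : Prime p) where
  open GroupTheory G
  open PrimeOrder G p-prime
  open ≡-Reasoning

  module _ {y : Carrier} (ord-y≡p : ord y ≡ p) (y∈Z : Z y) (comm∈⟨y⟩ : ∀ a b → ⁅ a , b ⁆ ∈ ⟨ y ⟩) where

    comm-central : ∀ a b → Z ⁅ a , b ⁆
    comm-central a b = ⟨⟩-minimal centre y∈Z (comm∈⟨y⟩ a b)

    open Class2 comm-central

    Nondegenerate : Subgroup → Set
    Nondegenerate S = ∀ {x} → x ∈ S → (∀ {s} → s ∈ S → ⁅ x , s ⁆ ≡ e) → Z x

    centraliserIn : Subgroup → Carrier → Subgroup
    centraliserIn A c = record
      { member  = λ s → s ∈ A × ⁅ s , c ⁆ ≡ e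
      ; member? = λ s → member? A s ×-dec (⁅ s , c ⁆ ≟ e)
      ; e∈      = e∈ , comm-centralˡ Z-e c
      ; ·∈      = λ (s∈A , [s,c]≡e) (t∈A , [t,c]≡e) → ·∈ s∈A t∈A , trans (comm-·ˡ _ _ c) (trans (cong₂ _·_ [s,c]≡e [t,c]≡e) (identityˡ e))
      ; inv∈    = λ (s∈A , [s,c]≡e) → inv∈ s∈A , trans (comm-invˡ _ c) (trans (cong inv [s,c]≡e) ε⁻¹≈ε)
      }
      where open Subgroup A using (e∈; ·∈; inv∈)

    comm-cancel : ∀ {d c} → ⁅ d , c ⁆ ≢ e → ∀ s → ∃ λ a → ⁅ s · inv (d ^ᵍ a) , c ⁆ ≡ e
    comm-cancel {d} {c} [d,c]≢e s with ⟨⟩-order-p ord-y≡p (comm∈⟨y⟩ d c) [d,c]≢e (comm∈⟨y⟩ s c)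
    ... | i , [s,c]≡[d,c]ⁱ = toℕ i , (begin
      ⁅ s · inv (d ^ᵍ toℕ i) , c ⁆                  ≡⟨ comm-·ˡ s _ c ⟩
      ⁅ s , c ⁆ · ⁅ inv (d ^ᵍ toℕ i) , c ⁆          ≡⟨ cong₂ _·_ [s,c]≡[d,c]ⁱ (comm-invˡ _ c) ⟩
      ⁅ d , c ⁆ ^ᵍ toℕ i · inv ⁅ d ^ᵍ toℕ i , c ⁆   ≡⟨ cong (λ t → ⁅ d , c ⁆ ^ᵍ toℕ i · inv t) (comm-^ᵍˡ d c (toℕ i)) ⟩
      ⁅ d , c ⁆ ^ᵍ toℕ i · inv (⁅ d , c ⁆ ^ᵍ toℕ i) ≡⟨ inverseʳ _ ⟩
      e                                             ∎)

    -- s ↦ ⁅ s , c ⁆ is a homomorphism from A onto ⟨ y ⟩, with kernel centraliserIn A c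
    size-centraliserIn : ∀ A {d c} → d ∈ A → ⁅ d , c ⁆ ≢ e → size A ≡ size (centraliserIn A c) * p
    size-centraliserIn A {d} {c} d∈A [d,c]≢e = begin
      size A                                                   ≡⟨ count-by-cosets A (centraliserIn A c) proj₁ ⁅_, c ⁆ ⁅a·k,c⁆≡⁅a,c⁆ ⁅a,c⁆≡⁅a′,c⁆⇒ ⟩
      size (centraliserIn A c) * count (image? (member? A) ⁅_, c ⁆) ≡⟨ cong (size (centraliserIn A c) *_) (count-cong (image? (member? A) ⁅_, c ⁆) (member? ⟨ y ⟩) (image⊆⟨y⟩ , ⟨y⟩⊆image)) ⟩
      size (centraliserIn A c) * size ⟨ y ⟩                    ≡⟨ cong (size (centraliserIn A c) *_) (trans (size-⟨⟩ y) ord-y≡p) ⟩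
      size (centraliserIn A c) * p                             ∎
      where
      ⁅a·k,c⁆≡⁅a,c⁆ : ∀ {a k} → k ∈ centraliserIn A c → ⁅ a · k , c ⁆ ≡ ⁅ a , c ⁆
      ⁅a·k,c⁆≡⁅a,c⁆ {a} {k} (_ , [k,c]≡e) = trans (comm-·ˡ a k c) (trans (cong (⁅ a , c ⁆ ·_) [k,c]≡e) (identityʳ _))
      ⁅a,c⁆≡⁅a′,c⁆⇒ : ∀ {a a′} → a ∈ A → a′ ∈ A → ⁅ a , c ⁆ ≡ ⁅ a′ , c ⁆ → inv a · a′ ∈ centraliserIn A c
      ⁅a,c⁆≡⁅a′,c⁆⇒ {a} {a′} a∈A a′∈A eq = Subgroup.·∈ A (Subgroup.inv∈ A a∈A) a′∈A , (begin
        ⁅ inv a · a′ , c ⁆             ≡⟨ comm-·ˡ (inv a) a′ c ⟩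
        ⁅ inv a , c ⁆ · ⁅ a′ , c ⁆     ≡⟨ cong₂ _·_ (comm-invˡ a c) (sym eq) ⟩
        inv ⁅ a , c ⁆ · ⁅ a , c ⁆      ≡⟨ inverseˡ _ ⟩
        e                              ∎)
      image⊆⟨y⟩ : ∀ {g} → Image (member A) ⁅_, c ⁆ g → g ∈ ⟨ y ⟩
      image⊆⟨y⟩ (s , _ , refl) = comm∈⟨y⟩ s c
      ⟨y⟩⊆image : ∀ {g} → g ∈ ⟨ y ⟩ → Image (member A) ⁅_, c ⁆ g
      ⟨y⟩⊆image g∈⟨y⟩ with ⟨⟩-order-p ord-y≡p (comm∈⟨y⟩ d c) [d,c]≢e g∈⟨y⟩
      ... | i , refl = d ^ᵍ toℕ i , Subgroup.^ᵍ∈ A d∈A (toℕ i) , comm-^ᵍˡ d c (toℕ i)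

    module _ (S : Subgroup) {x w} (x∈S : x ∈ S) (w∈S : w ∈ S) ([x,w]≢e : ⁅ x , w ⁆ ≢ e) where
      open Subgroup S using (·∈; inv∈; ^ᵍ∈)

      private
        [w,x]≢e : ⁅ w , x ⁆ ≢ e
        [w,x]≢e [w,x]≡e = [x,w]≢e (trans (comm-flip w x) (trans (cong inv [w,x]≡e) ε⁻¹≈ε))

        w∈C[w] : w ∈ centraliserIn S w
        w∈C[w] = w∈S , commute⇒comm≡e refl

      reduct : Subgroup
      reduct = centraliserIn (centraliserIn S w) x

      size-reduct : size S ≡ size reduct * p * p
      size-reduct = trans (size-centraliserIn S x∈S [x,w]≢e) (cong (_* p) (size-centraliserIn (centraliserIn S w) w∈C[w] [w,x]≢e))

      centre⊆reduct : (∀ {z} → Z z → z ∈ S) → ∀ {z} → Z z → z ∈ reduct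
      centre⊆reduct Z⊆S z∈Z = (Z⊆S z∈Z , comm-centralˡ z∈Z w) , comm-centralˡ z∈Z x

      -- every s ∈ S is s₂ · wᵇ · xᵃ with s₂ in the reduct
      reduct-nondegenerate : Nondegenerate S → Nondegenerate reduct
      reduct-nondegenerate S-nondeg {t} t∈T t⊥T = S-nondeg (proj₁ (proj₁ t∈T)) [t,s]≡e
        where
        [t,s]≡e : ∀ {s} → s ∈ S → ⁅ t , s ⁆ ≡ e
        [t,s]≡e {s} s∈S = begin
          ⁅ t , s ⁆                                      ≡⟨ cong ⁅ t ,_⁆ s≡s₂wᵇxᵃ ⟩
          ⁅ t , (s₂ · w ^ᵍ b) · x ^ᵍ a ⁆                 ≡⟨ comm-·ʳ t _ _ ⟩
          ⁅ t , s₂ · w ^ᵍ b ⁆ · ⁅ t , x ^ᵍ a ⁆           ≡⟨ cong (_· ⁅ t , x ^ᵍ a ⁆) (comm-·ʳ t s₂ _) ⟩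
          (⁅ t , s₂ ⁆ · ⁅ t , w ^ᵍ b ⁆) · ⁅ t , x ^ᵍ a ⁆ ≡⟨ cong₂ (λ u v → (⁅ t , s₂ ⁆ · u) · v) (comm-^ᵍʳ t w b) (comm-^ᵍʳ t x a) ⟩
          (⁅ t , s₂ ⁆ · ⁅ t , w ⁆ ^ᵍ b) · ⁅ t , x ⁆ ^ᵍ a ≡⟨ cong₂ (λ u v → (⁅ t , s₂ ⁆ · u ^ᵍ b) · v ^ᵍ a) (proj₂ (proj₁ t∈T)) (proj₂ t∈T) ⟩
          (⁅ t , s₂ ⁆ · e ^ᵍ b) · e ^ᵍ a                 ≡⟨ cong₂ (λ u v → (u · e ^ᵍ b) · v) (t⊥T s₂∈T) (e^ᵍ a) ⟩
          (e · e ^ᵍ b) · e                               ≡⟨ trans (identityʳ _) (trans (identityˡ _) (e^ᵍ b)) ⟩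
          e                                              ∎
          where
          a : ℕ
          a = proj₁ (comm-cancel [x,w]≢e s)
          s₁ : Carrier
          s₁ = s · inv (x ^ᵍ a)
          s₁∈C[w] : s₁ ∈ centraliserIn S w
          s₁∈C[w] = ·∈ s∈S (inv∈ (^ᵍ∈ x∈S a)) , proj₂ (comm-cancel [x,w]≢e s)
          b : ℕ
          b = proj₁ (comm-cancel [w,x]≢e s₁)
          s₂ : Carrier
          s₂ = s₁ · inv (w ^ᵍ b)
          s₂∈T : s₂ ∈ reduct
          s₂∈T = Subgroup.·∈ (centraliserIn S w) s₁∈C[w] (Subgroup.inv∈ (centraliserIn S w) (Subgroup.^ᵍ∈ (centraliserIn S w) w∈C[w] b))
               , proj₂ (comm-cancel [w,x]≢e s₁)
          s≡s₂wᵇxᵃ : s ≡ (s₂ · w ^ᵍ b) · x ^ᵍ a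
          s≡s₂wᵇxᵃ = sym (trans (cong (_· x ^ᵍ a) (//-rightDividesˡ (w ^ᵍ b) s₁)) (//-rightDividesˡ (x ^ᵍ a) s))

    private
      p^[2+2n] : ∀ c n → c * p ^ (2 * n) * p * p ≡ c * p ^ (2 * suc n)
      p^[2+2n] c n = begin
        c * p ^ (2 * n) * p * p     ≡⟨ solve 3 (λ c q p → c :* q :* p :* p := c :* (p :* (p :* q))) refl c (p ^ (2 * n)) p ⟩
        c * (p * (p * p ^ (2 * n))) ≡⟨ cong (λ m → c * p ^ m) (sym (*-suc 2 n)) ⟩
        c * p ^ (2 * suc n)         ∎
        where open +-*-Solver

      symplectic-bounded : ∀ bound (S : Subgroup) → size S ≤ bound → (∀ {z} → Z z → z ∈ S) → Nondegenerate S →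
                           ∃ λ n → size S ≡ size centre * p ^ (2 * n)
      symplectic-bounded zero S size≤0 _ _ = contradiction size≤0 (<⇒≱ (∈⇒0<count (member? S) (Subgroup.e∈ S)))
      symplectic-bounded (suc bound) S size≤ Z⊆S S-nondeg = go (all? (λ s → member? S s →-dec Z? s))
        where
        go : Dec (∀ s → s ∈ S → Z s) → ∃ λ n → size S ≡ size centre * p ^ (2 * n)
        go (yes S⊆Z) = 0 , trans (count-cong (member? S) Z? ((λ {s} → S⊆Z s) , Z⊆S)) (sym (*-identityʳ _))
        go (no  S⊈Z) = suc n , trans (size-reduct S x∈S w∈S [x,w]≢e) (trans (cong (λ m → m * p * p) size-T≡) (p^[2+2n] (size centre) n))
          where
          noncentral : ∃ λ x → x ∈ S × ¬ Z x
          noncentral = ¬⊆⇒∃∖ (member? S) Z? S⊈Z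
          x : Carrier
          x = proj₁ noncentral
          x∈S : x ∈ S
          x∈S = proj₁ (proj₂ noncentral)
          partner : ∃ λ w → w ∈ S × ⁅ x , w ⁆ ≢ e
          partner = ¬⊆⇒∃∖ (member? S) (λ s → ⁅ x , s ⁆ ≟ e) (λ x⊥S → proj₂ (proj₂ noncentral) (S-nondeg x∈S (x⊥S _)))
          w : Carrier
          w = proj₁ partner
          w∈S : w ∈ S
          w∈S = proj₁ (proj₂ partner)
          [x,w]≢e : ⁅ x , w ⁆ ≢ e
          [x,w]≢e = proj₂ (proj₂ partner)
          T : Subgroup
          T = reduct S x∈S w∈S [x,w]≢e
          instance
            p-nonZero : NonZero p
            p-nonZero = prime⇒nonZero p-prime
            T-nonZero : NonZero (size T)
            T-nonZero = >-nonZero (∈⇒0<count (member? T) (Subgroup.e∈ T))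
          T<S : size T < size S
          T<S = <-≤-trans (m<m*n (size T) p (prime⇒1<p p-prime))
                  (≤-trans (m≤m*n (size T * p) p) (≤-reflexive (sym (size-reduct S x∈S w∈S [x,w]≢e))))
          IH : ∃ λ n → size T ≡ size centre * p ^ (2 * n)
          IH = symplectic-bounded bound T (≤-pred (≤-trans T<S size≤)) (centre⊆reduct S x∈S w∈S [x,w]≢e Z⊆S)
                 (reduct-nondegenerate S x∈S w∈S [x,w]≢e S-nondeg)
          n : ℕ
          n = proj₁ IH
          size-T≡ : size T ≡ size centre * p ^ (2 * n)
          size-T≡ = proj₂ IH

    index-centre : ∃ λ n → order ≡ size centre * p ^ (2 * n)
    index-centre =
      let (n , size≡) = symplectic-bounded order whole (≤-reflexive size-whole) _ (λ {x} _ x⊥G g → comm≡e⇒commute (x⊥G {g} _))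
      in n , trans (sym size-whole) size≡

    private
      Z-inv·e : ∀ {x} → Z x → Z (inv x · e)
      Z-inv·e {x} x∈Z = subst Z (sym (identityʳ (inv x))) (Z-inv x∈Z)

    commutatorForm : CommutatorFormOnCentralQuotient G
    commutatorForm = well-defined , (λ x y → gen-s (x , y , refl)) , comm-·ˡ , comm-·ʳ , comm-flip
                   , λ x x⊥G → Z-inv·e (λ g → comm≡e⇒commute (x⊥G g))
      where
      well-defined : ∀ x x′ y y′ → Z (inv x · x′) → Z (inv y · y′) → ⁅ x , y ⁆ ≡ ⁅ x′ , y′ ⁆
      well-defined x x′ y y′ z₁∈Z z₂∈Z = sym (begin
        ⁅ x′ , y′ ⁆                              ≡⟨ cong₂ ⁅_,_⁆ (sym (\\-leftDividesˡ x x′)) (sym (\\-leftDividesˡ y y′)) ⟩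
        ⁅ x · z₁ , y · z₂ ⁆                      ≡⟨ comm-·ˡ x z₁ (y · z₂) ⟩
        ⁅ x , y · z₂ ⁆ · ⁅ z₁ , y · z₂ ⁆         ≡⟨ cong₂ _·_ (comm-·ʳ x y z₂) (comm-centralˡ z₁∈Z (y · z₂)) ⟩
        (⁅ x , y ⁆ · ⁅ x , z₂ ⁆) · e             ≡⟨ cong (λ t → (⁅ x , y ⁆ · t) · e) (comm-centralʳ z₂∈Z x) ⟩
        (⁅ x , y ⁆ · e) · e                      ≡⟨ trans (identityʳ _) (identityʳ _) ⟩
        ⁅ x , y ⁆                                ∎)
        where
        z₁ = inv x · x′
        z₂ = inv y · y′

    central-quotient : ∃ λ n → order ≡ size centre * p ^ (2 * n) × QuotientElemAbelian G Z p (2 * n)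
    central-quotient = n , order≡ , xy∼yx , x^p∼e , subst (QuotientSize G Z) r≡p^[2n] quotientSize
      where
      open Quotient G centre (central⇒normal centre (λ z∈Z → z∈Z))
      n : ℕ
      n = proj₁ index-centre
      order≡ : order ≡ size centre * p ^ (2 * n)
      order≡ = proj₂ index-centre
      instance
        centre-nonZero : NonZero (size centre)
        centre-nonZero = >-nonZero (∈⇒0<count Z? Z-e)
      r≡p^[2n] : r ≡ p ^ (2 * n)
      r≡p^[2n] = *-cancelˡ-≡ r (p ^ (2 * n)) (size centre) (trans (sym order≡size*r) order≡)
      xy∼yx : ∀ x y → Z (inv (x · y) · (y · x))
      xy∼yx x y = subst Z (sym (inv[xy]·yx≡comm x y)) (comm-central y x)
      x^p∼e : ∀ x → Z (inv (x ^ᵍ p) · e)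
      x^p∼e x = Z-inv·e λ g → comm≡e⇒commute (begin
        ⁅ x ^ᵍ p , g ⁆    ≡⟨ comm-^ᵍˡ x g p ⟩
        ⁅ x , g ⁆ ^ᵍ p    ≡⟨ subst (λ m → ⁅ x , g ⁆ ^ᵍ m ≡ e) ord-y≡p (^ᵍ-ord-∈⟨⟩ (comm∈⟨y⟩ x g)) ⟩
        e                 ∎)

module Characterisation (G : FinGroup) {p : ℕ} (p-prime : Prime p) (G-p : IsPGroup p G) where
  open GroupTheory G
  open PrimeOrder G p-prime
  open PGroup G p-prime G-p
  open Symplectic G p-prime

  private
    k : ℕ
    k = proj₁ G-p
    order≡p^k : order ≡ p ^ k
    order≡p^k = proj₂ G-p

    powers-derived : ∀ {c g} → Derived G c → g ∈ ⟨ c ⟩ → Derived G g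
    powers-derived c∈G′ (i , refl) = Derived-^ᵍ c∈G′ (toℕ i)

  module Forward (G-nonabelian : Nonabelian G) (G-minimal : ∀ H → IsPGroup p H → Nonabelian H → H ≼ G → H ≅ G) where

    comm∈normal : (N : Subgroup) → IsNormal G (member N) → ∀ {x} → x ∈ N → x ≢ e → ∀ a b → ⁅ a , b ⁆ ∈ N
    comm∈normal N N-normal {x} x∈N x≢e a b = decide (all? λ i → all? λ j → i ·Q j ≟ᶠ j ·Q i)
      where
      open Quotient G N N-normal
      Q-p : IsPGroup p Q
      Q-p = ∣p^k⇒≡p^i p-prime k (subst (r ∣_) order≡p^k r∣order)
      Q≇G : ¬ (Q ≅ G)
      Q≇G Q≅G = <-irrefl (≅⇒order≡ {Q} {G} Q≅G) (nontrivial⇒r<order x∈N x≢e)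
      decide : Dec (Abelian Q) → ⁅ a , b ⁆ ∈ N
      decide (yes Q-abelian)    = Q-abelian⇒comm∈N Q-abelian a b
      decide (no  Q-nonabelian) = contradiction (G-minimal Q Q-p Q-nonabelian Q≼G) Q≇G

    private
      noncommuting : ∃ λ a → ∃ λ b → ⁅ a , b ⁆ ≢ e
      noncommuting = nonabelian⇒noncommuting G-nonabelian
      a₀ b₀ c₀ : Carrier
      a₀ = proj₁ noncommuting
      b₀ = proj₁ (proj₂ noncommuting)
      c₀ = ⁅ a₀ , b₀ ⁆
      c₀≢e : c₀ ≢ e
      c₀≢e = proj₂ (proj₂ noncommuting)
      c₀∈G′ : Derived G c₀
      c₀∈G′ = gen-s (a₀ , b₀ , refl)

    central-order-p : ∃ λ y → Z y × ord y ≡ p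
    central-order-p =
      let (z , z∈Z , z≢e) = centre-nontrivial c₀≢e
          (m , ord≡p)     = power-of-order-p z≢e
      in z ^ᵍ m , Z-^ᵍ z∈Z m , ord≡p

    private
      y₀ : Carrier
      y₀ = proj₁ central-order-p
      y₀∈Z : Z y₀
      y₀∈Z = proj₁ (proj₂ central-order-p)
      ord-y₀≡p : ord y₀ ≡ p
      ord-y₀≡p = proj₂ (proj₂ central-order-p)

    comm∈⟨y₀⟩ : ∀ a b → ⁅ a , b ⁆ ∈ ⟨ y₀ ⟩
    comm∈⟨y₀⟩ = comm∈normal ⟨ y₀ ⟩ (central⇒normal ⟨ y₀ ⟩ (⟨⟩-minimal centre y₀∈Z)) (x∈⟨x⟩ y₀) (ord≡p⇒≢e ord-y₀≡p)

    G′⊆⟨y₀⟩ : ∀ {g} → Derived G g → g ∈ ⟨ y₀ ⟩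
    G′⊆⟨y₀⟩ = Derived-minimal ⟨ y₀ ⟩ comm∈⟨y₀⟩

    ⟨y₀⟩⊆G′ : ∀ {g} → g ∈ ⟨ y₀ ⟩ → Derived G g
    ⟨y₀⟩⊆G′ g∈⟨y₀⟩ = powers-derived c₀∈G′ (⟨⟩-order-p ord-y₀≡p (comm∈⟨y₀⟩ a₀ b₀) c₀≢e g∈⟨y₀⟩)

    G′⊆Z : ∀ {g} → Derived G g → Z g
    G′⊆Z = ⟨⟩-minimal centre y₀∈Z ∘ G′⊆⟨y₀⟩

    central-order-p⊆⟨y₀⟩ : ∀ {w} → Z w → w ^ᵍ p ≡ e → w ∈ ⟨ y₀ ⟩
    central-order-p⊆⟨y₀⟩ {w} w∈Z w^p≡e = decide (w ≟ e)
      where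
      decide : Dec (w ≡ e) → w ∈ ⟨ y₀ ⟩
      decide (yes refl) = Subgroup.e∈ ⟨ y₀ ⟩
      decide (no  w≢e)  = G′⊆⟨y₀⟩ (powers-derived c₀∈G′ (⟨⟩-order-p (ord≡p w≢e w^p≡e) c₀∈⟨w⟩ c₀≢e (x∈⟨x⟩ w)))
        where
        c₀∈⟨w⟩ : c₀ ∈ ⟨ w ⟩
        c₀∈⟨w⟩ = comm∈normal ⟨ w ⟩ (central⇒normal ⟨ w ⟩ (⟨⟩-minimal centre w∈Z)) (x∈⟨x⟩ w) w≢e a₀ b₀

    nilpotentClass2 : NilpotentClass2 G
    nilpotentClass2 = (c₀ , c₀∈G′ , c₀≢e) , λ c g c∈G′ → comm-centralˡ (G′⊆Z c∈G′) g

    centre-size : ∃ λ d → 1 ≤ d × size centre ≡ p ^ d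
    centre-size = from-p-power (size-p-power centre)
      where
      from-p-power : (∃ λ d → size centre ≡ p ^ d) → ∃ λ d → 1 ≤ d × size centre ≡ p ^ d
      from-p-power (zero  , size≡1) = contradiction (≤-trans (≢⇒2≤count Z? Z-e y₀∈Z (ord≡p⇒≢e ord-y₀≡p ∘ sym)) (≤-reflexive size≡1))
                                                    λ { (s≤s ()) }
      from-p-power (suc d , size≡p^d) = suc d , s≤s z≤n , size≡p^d

    centre-cyclic : ∃ λ d → 1 ≤ d × (∃ λ z → Z z × (∀ x → Z x → ∃ λ n → x ≡ pow G z n)) × HasSize Z (p ^ d)
    centre-cyclic = proj₁ centre-size , proj₁ (proj₂ centre-size) , (z , z∈Z , λ _ → generated)
                  , subst (HasSize Z) (proj₂ (proj₂ centre-size)) (count-hasSize Z?)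
      where
      cyclic : ∃ λ z → Z z × (∀ {x} → Z x → ∃ λ n → x ≡ z ^ᵍ n)
      cyclic = unique-order-p⇒cyclic centre (λ x∈Z _ → x∈Z _) y₀∈Z ord-y₀≡p central-order-p⊆⟨y₀⟩
      z : Carrier
      z = proj₁ cyclic
      z∈Z : Z z
      z∈Z = proj₁ (proj₂ cyclic)
      generated : ∀ {x} → Z x → ∃ λ n → x ≡ z ^ᵍ n
      generated = proj₂ (proj₂ cyclic)

    derived-order-p : (∀ g → Derived G g → Z g) × HasSize (Derived G) p
    derived-order-p = (λ _ → G′⊆Z) , hasSize-cong (⟨y₀⟩⊆G′ , G′⊆⟨y₀⟩)
      (subst (HasSize (member ⟨ y₀ ⟩)) (trans (size-⟨⟩ y₀) ord-y₀≡p) (count-hasSize (member? ⟨ y₀ ⟩)))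

    symplectic : ∃ λ n → 1 ≤ n × QuotientElemAbelian G Z p (2 * n) × CommutatorFormOnCentralQuotient G
    symplectic = from-index (central-quotient ord-y₀≡p y₀∈Z comm∈⟨y₀⟩)
      where
      from-index : (∃ λ n → order ≡ size centre * p ^ (2 * n) × QuotientElemAbelian G Z p (2 * n)) →
                   ∃ λ n → 1 ≤ n × QuotientElemAbelian G Z p (2 * n) × CommutatorFormOnCentralQuotient G
      from-index (zero  , order≡ , _) = contradiction (λ x → count-≥⇒⊇ Z? U? _ (≤-reflexive (trans count-U (trans order≡ (*-identityʳ _)))) {x} tt)
                                                       G-nonabelian
      from-index (suc n , _ , quotient) = suc n , s≤s z≤n , quotient , commutatorForm ord-y₀≡p y₀∈Z comm∈⟨y₀⟩

  module Reverse (class2 : NilpotentClass2 G)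
                 (centre-cyclic : ∃ λ d → 1 ≤ d × (∃ λ z → Z z × (∀ x → Z x → ∃ λ n → x ≡ pow G z n)) × HasSize Z (p ^ d))
                 (G′⊆Z : ∀ x → Derived G x → Z x) (derived-size : HasSize (Derived G) p) where

    derived : Subgroup
    derived = record { member = Derived G ; member? = hasSize⇒decidable derived-size
                     ; e∈ = gen-e ; ·∈ = gen-mul ; inv∈ = gen-inv }

    private
      c₁ : Carrier
      c₁ = proj₁ (proj₁ class2)
      c₁∈G′ : Derived G c₁
      c₁∈G′ = proj₁ (proj₂ (proj₁ class2))
      c₁≢e : c₁ ≢ e
      c₁≢e = proj₂ (proj₂ (proj₁ class2))

      size-derived : size derived ≡ p
      size-derived = hasSize⇒count≡ (member? derived) derived-size

    nonabelian : Nonabelian G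
    nonabelian G-abelian = c₁≢e (Derived-minimal trivialSubgroup (λ x y → commute⇒comm≡e (G-abelian x y)) c₁∈G′)

    ord-c₁≡p : ord c₁ ≡ p
    ord-c₁≡p = ord∣p⇒ord≡p c₁≢e (subst₂ _∣_ (size-⟨⟩ c₁) size-derived (size-∣ ⟨ c₁ ⟩ derived (powers-derived c₁∈G′)))

    G′⊆⟨c⟩ : ∀ {c} → Derived G c → c ≢ e → derived ⊆ ⟨ c ⟩
    G′⊆⟨c⟩ c∈G′ c≢e g∈G′ = ⟨⟩-order-p ord-c₁≡p (G′⊆⟨c₁⟩ c∈G′) c≢e (G′⊆⟨c₁⟩ g∈G′)
      where
      G′⊆⟨c₁⟩ : derived ⊆ ⟨ c₁ ⟩
      G′⊆⟨c₁⟩ = count-≥⇒⊇ (member? ⟨ c₁ ⟩) (member? derived) (powers-derived c₁∈G′)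
                  (≤-reflexive (trans size-derived (sym (trans (size-⟨⟩ c₁) ord-c₁≡p))))

    private
      d : ℕ
      d = proj₁ centre-cyclic
      z : Carrier
      z = proj₁ (proj₁ (proj₂ (proj₂ centre-cyclic)))
      z∈Z : Z z
      z∈Z = proj₁ (proj₂ (proj₁ (proj₂ (proj₂ centre-cyclic))))
      Z⊆⟨z⟩ : ∀ {g} → Z g → g ∈ ⟨ z ⟩
      Z⊆⟨z⟩ {g} g∈Z = let (n , g≡zⁿ) = proj₂ (proj₂ (proj₁ (proj₂ (proj₂ centre-cyclic)))) g g∈Z
                      in subst (_∈ ⟨ z ⟩) (sym g≡zⁿ) (^ᵍ∈⟨⟩ z n)

    ord-z≡p^d : ord z ≡ p ^ d
    ord-z≡p^d = trans (sym (size-⟨⟩ z))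
      (hasSize-unique (⟨⟩-minimal centre z∈Z , Z⊆⟨z⟩) (count-hasSize (member? ⟨ z ⟩)) (proj₂ (proj₂ (proj₂ centre-cyclic))))

    unique-central-subgroup : ∃ λ u → ord u ≡ p × (∀ {w} → Z w → w ^ᵍ p ≡ e → w ∈ ⟨ u ⟩)
    unique-central-subgroup = from-exponent d ord-z≡p^d (proj₁ (proj₂ centre-cyclic))
      where
      from-exponent : ∀ d′ → ord z ≡ p ^ d′ → 1 ≤ d′ → ∃ λ u → ord u ≡ p × (∀ {w} → Z w → w ^ᵍ p ≡ e → w ∈ ⟨ u ⟩)
      from-exponent (suc a) ord-z≡p^[1+a] _ = z ^ᵍ (p ^ a) , ord-^ᵍp^a a ord-z≡p^[1+a]
                                            , λ w∈Z w^p≡e → ⟨⟩-socle {a = a} ord-z≡p^[1+a] (Z⊆⟨z⟩ w∈Z) w^p≡e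

    module _ (N : Carrier → Set) (N-normal : IsNormal G N) where
      open IsNormal N-normal

      private
        N-^ᵍ : ∀ {x} → N x → ∀ n → N (x ^ᵍ n)
        N-^ᵍ x∈N zero    = N-e
        N-^ᵍ x∈N (suc n) = N-mul x∈N (N-^ᵍ x∈N n)

        ⟨⟩⊆N : ∀ {x g} → N x → g ∈ ⟨ x ⟩ → N g
        ⟨⟩⊆N x∈N (i , refl) = N-^ᵍ x∈N (toℕ i)

      normal-meets-derived : ∀ {x} → N x → x ≢ e → ∃ λ c → N c × Derived G c × c ≢ e
      normal-meets-derived {x} x∈N x≢e = decide (Z? x)
        where
        decide : Dec (Z x) → ∃ λ c → N c × Derived G c × c ≢ e
        decide (no x∉Z) =
          let (y , xy≢yx) = ¬∀⟶∃¬ order (λ y → x · y ≡ y · x) (λ y → x · y ≟ y · x) x∉Z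
          in ⁅ x , y ⁆ , N-mul (N-inv x∈N) (N-conj y x∈N) , gen-s (x , y , refl) , xy≢yx ∘ comm≡e⇒commute
        decide (yes x∈Z) =
          let (u , ord-u≡p , order-p⊆⟨u⟩) = unique-central-subgroup
              (m , ord-xᵐ≡p)              = power-of-order-p x≢e
              xᵐ∈⟨u⟩ = order-p⊆⟨u⟩ (Z-^ᵍ x∈Z m) (ord≡p⇒^ᵍp≡e ord-xᵐ≡p)
              c₁∈⟨u⟩ = order-p⊆⟨u⟩ (G′⊆Z c₁ c₁∈G′) (ord≡p⇒^ᵍp≡e ord-c₁≡p)
          in c₁ , ⟨⟩⊆N (N-^ᵍ x∈N m) (⟨⟩-order-p ord-u≡p xᵐ∈⟨u⟩ (ord≡p⇒≢e ord-xᵐ≡p) c₁∈⟨u⟩) , c₁∈G′ , c₁≢e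

      nontrivial-normal⇒comm∈ : ∀ {x} → N x → x ≢ e → ∀ a b → N ⁅ a , b ⁆
      nontrivial-normal⇒comm∈ x∈N x≢e a b =
        let (c , c∈N , c∈G′ , c≢e) = normal-meets-derived x∈N x≢e
        in ⟨⟩⊆N c∈N (G′⊆⟨c⟩ c∈G′ c≢e (gen-s (a , b , refl)))

    minimal : ∀ H → Nonabelian H → H ≼ G → H ≅ G
    minimal H H-nonabelian (N , N-normal , f , f-hom , f-injective , f-onto) =
      f , (λ a b → trivial (f-hom a b)) , (λ a b fa≡fb → f-injective a b (subst (λ y → N (inv (f a) · y)) fa≡fb ~-refl))
        , λ g → proj₁ (f-onto g) , trivial (proj₂ (f-onto g))
      where
      open IsNormal N-normal using (N-e; N-mul; N-inv)
      open IsEquivalence (coset-isEquivalence {N} N-e N-mul N-inv) using ()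
        renaming (refl to ~-refl; sym to ~-sym; trans to ~-trans)
      module H = FinGroup H
      fa·fb~fb·fa : ∀ {x} → N x → x ≢ e → ∀ a b → N (inv (f a · f b) · (f b · f a))
      fa·fb~fb·fa x∈N x≢e a b = subst N (sym (inv[xy]·yx≡comm (f a) (f b))) (nontrivial-normal⇒comm∈ N N-normal x∈N x≢e (f b) (f a))
      N⊆e : ∀ {x} → N x → x ≡ e
      N⊆e {x} x∈N = decide (x ≟ e)
        where
        decide : Dec (x ≡ e) → x ≡ e
        decide (yes x≡e) = x≡e
        decide (no  x≢e) = contradiction
          (λ a b → f-injective (a H.· b) (b H.· a) (~-trans (f-hom a b) (~-trans (fa·fb~fb·fa x∈N x≢e a b) (~-sym (f-hom b a)))))
          H-nonabelian
      trivial : ∀ {x y} → N (inv x · y) → x ≡ y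
      trivial = inv·≡e⇒≡ ∘ N⊆e

proposition4p1 : (p : ℕ) → Prime p → 2 < p → (G : FinGroup) → IsPGroup p G →
    MinimalNonabelian p G ⇔
      (NilpotentClass2 G ×
       (∃ λ d → 1 ≤ d × (∃ λ z → Center G z × (∀ x → Center G x → ∃ λ k → x ≡ pow G z k)) × HasSize (Center G) (p ^ d)) ×
       ((∀ x → Derived G x → Center G x) × HasSize (Derived G) p) ×
       (∃ λ n → 1 ≤ n × QuotientElemAbelian G (Center G) p (2 * n) × CommutatorFormOnCentralQuotient G))
proposition4p1 p p-prime _ G G-p = mk⇔
  (λ (_ , G-nonabelian , G-minimal) → let open Forward G-nonabelian G-minimal in
    nilpotentClass2 , centre-cyclic , derived-order-p , symplectic)
  (λ (class2 , centre-cyclic , (G′⊆Z , derived-size) , _) → let open Reverse class2 centre-cyclic G′⊆Z derived-size in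
    G-p , nonabelian , λ H _ → minimal H)
  where open Characterisation G p-prime G-p
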